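{- Let $S=\{i_1<\cdots<i_s\}$ be a finite set of positive integers (not depending on $n$) which is admissible, i.e. $\#P(S;n)\neq 0$ for some $n$. Then there is a polynomial $p(n)=p(S;n)$, depending on $S$, such that $p(n)$ is an integer for every integer $n$ and $$\#P(S;n)=p(n)\,2^{n-\#S-1}$$ for every $n$ for which $\#P(S;n)\neq 0$. Moreover $\deg p(n)=i_s-1$ if $S\neq\emptyset$, and $\deg p(n)=0$ if $S=\emptyset$.
   Context: For $n\ge 1$, $\mathfrak S_n$ is the set of permutations $\pi=a_1\ldots a_n$ of $[n]=\{1,\ldots,n\}$. An index $i$ is a peak of $\pi$ if $a_{i-1}<a_i>a_{i+1}$; the peak set $P(\pi)$ is the set of peaks of $\pi$ (so $P(\pi)\subseteq\{2,\ldots,n-1\}$). For a set $S$ of positive integers, $P(S;n)=\{\pi\in\mathfrak S_n : P(\pi)=S\}$. For a nonempty admissible $S$, $\#P(S;n)\ne 0$ holds exactly for $n\ge \max S+1$. -}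

module Defs where

open import Data.Nat using (ℕ; zero; suc; _<ᵇ_; _∸_; _⊔_; _≤_)
open import Data.Bool using (Bool; true; false; _∧_; if_then_else_; T)
open import Data.Fin using (Fin; toℕ)
open import Data.Fin.Properties using (_≟_)
open import Data.Vec using (Vec; toList)
open import Data.List using (List; []; _∷_; map; length; foldr; _++_; [_])
open import Data.Integer using (ℤ; +_)
open import Data.Rational using (ℚ; _/_; _+_; _*_; 0ℚ)
open import Data.Product using (Σ; ∃; _×_)
open import Relation.Nullary.Decidable using (⌊_⌋)
open import Relation.Binary.PropositionalEquality using (_≡_; _≢_)
open import Function.Bundles using (_↔_)
import Data.List.Relation.Unary.Unique.DecPropositional as UniqueDec
open import Data.List.Relation.Unary.Linked using (Linked)
open import Data.List.Relation.Unary.All using (All)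

-- Permutations of [n]: a word a₁…aₙ stored as a Vec (Fin n) n (the
-- value a_i is represented by toℕ a_i ∈ {0,…,n-1}, i.e. shifted by one,
-- which does not affect comparisons) whose entries are pairwise distinct.

isPerm : ∀ {n} → Vec (Fin n) n → Bool
isPerm v = ⌊ UniqueDec.unique? _≟_ (toList v) ⌋

-- Peaks of a word of naturals, positions 1-indexed:
-- peaksFrom k (a ∷ b ∷ c ∷ rest), where a sits at position k, reports
-- position k+1 iff a < b > c, then continues.
peaksFrom : ℕ → List ℕ → List ℕ
peaksFrom k (a ∷ b ∷ c ∷ rest) =
  if (a <ᵇ b) ∧ (c <ᵇ b)
  then suc k ∷ peaksFrom (suc k) (b ∷ c ∷ rest)
  else peaksFrom (suc k) (b ∷ c ∷ rest)
peaksFrom k _ = []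

peakSet : ∀ {n} → Vec (Fin n) n → List ℕ
peakSet v = peaksFrom 1 (map toℕ (toList v))

-- P(S;n) = { π ∈ 𝔖ₙ : P(π) = S }, where S is given as a strictly
-- increasing list (so list equality = set equality).
PS : List ℕ → ℕ → Set
PS S n = Σ (Vec (Fin n) n) (λ v → T (isPerm v) × peakSet v ≡ S)

HasCard : Set → ℕ → Set
HasCard X m = Fin m ↔ X

IsFinPosSet : List ℕ → Set
IsFinPosSet S = Linked Data.Nat._<_ S × All (λ i → 1 ≤ i) S

Admissible : List ℕ → Set
Admissible S = ∃ λ n → 1 ≤ n × (∃ λ m → HasCard (PS S n) m × m ≢ 0)

-- Polynomials with rational coefficients, as coefficient lists c₀ ∷ c₁ ∷ …

evalPoly : List ℚ → ℤ → ℚ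
evalPoly cs z = foldr (λ c acc → c + (z / 1) * acc) 0ℚ cs

IntegerValued : List ℚ → Set
IntegerValued cs = ∀ (z : ℤ) → ∃ λ k → evalPoly cs z ≡ k / 1

HasDegree : List ℚ → ℕ → Set
HasDegree cs d = Σ (List ℚ) λ init → Σ ℚ λ c →
  cs ≡ init ++ [ c ] × length init ≡ d × c ≢ 0ℚ

expectedDeg : List ℕ → ℕ
expectedDeg [] = 0
expectedDeg (x ∷ xs) = foldr _⊔_ 0 (x ∷ xs) ∸ 1

module Submission where

-- Permutations of [n] are coded by inversion sequences c₁…c_n
-- (c_i < i) through the Lehmer code of the reversed permutation, which keeps
-- the up/down pattern and hence the peak set (LehmerCode,
-- PermutationVectors); so #P(S;n) = #Codes S n.  For codes there is a
-- cut-and-count recurrence: with S = S₁ ++ [k+1] and n = k + l,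
--   #Codes S n + #Codes S₁ n + #Codes (S₁ ++ [k]) n
--     = #Codes S₁ k · C(n, k) · 2^(l−1)                        (PeakRecurrence),
-- the last two factors counting peak-free tails (PeakFreeTailCount).  By
-- induction on max S this yields p_S = p_{S₁}(k)·C(z, k) − 2p_{S₁} − p_{S₂}
-- (PeakPolynomials), built from binomial polynomials (IntegerPolynomials);
-- p_{S₁}(k) ≠ 0 exactly when S is admissible, which pins the degree.

module Booleans where

  -- Boolean reflection: the combinatorial predicates below are Boolean-valued
  -- (so that the sets they cut out are decidable and hence finite), and these
  -- lemmas move between 'T b' and the propositions b decides.

  open import Data.Nat using (ℕ; _<ᵇ_; _≡ᵇ_; _≤_; _<_)
  open import Data.Nat.Properties
    using (<⇒<ᵇ; <ᵇ⇒<; <⇒≱; ≮⇒≥; <⇒≤; ≤∧≢⇒<; ≡ᵇ⇒≡; ≡⇒≡ᵇ; _<?_)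
  open import Data.Bool using (Bool; true; false; _∧_; not; T)
  open import Data.List using (List; []; _∷_)
  open import Data.Sum using (_⊎_; inj₁; inj₂)
  open import Data.Empty using (⊥; ⊥-elim)
  open import Data.Unit using (tt)
  open import Relation.Nullary using (yes; no)
  open import Relation.Binary.PropositionalEquality

  ∧-intro : ∀ {a b} → T a → T b → T (a ∧ b)
  ∧-intro {true} {true} _ _ = tt

  ∧-fst : ∀ {a b} → T (a ∧ b) → T a
  ∧-fst {true} _ = tt

  ∧-snd : ∀ {a b} → T (a ∧ b) → T b
  ∧-snd {true} p = p

  ¬T⇒T-not : ∀ {b} → (T b → ⊥) → T (not b)
  ¬T⇒T-not {true} f = f tt
  ¬T⇒T-not {false} f = tt

  T-not⇒¬T : ∀ {b} → T (not b) → T b → ⊥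
  T-not⇒¬T {true} () _
  T-not⇒¬T {false} _ ()

  <-or-≥ : ∀ a b → a < b ⊎ b ≤ a
  <-or-≥ a b with a <? b
  ... | yes p = inj₁ p
  ... | no p = inj₂ (≮⇒≥ p)

  <⇒<ᵇ≡true : ∀ {m n} → m < n → (m <ᵇ n) ≡ true
  <⇒<ᵇ≡true {m} {n} p with m <ᵇ n | <⇒<ᵇ p
  ... | true | _ = refl

  ≥⇒<ᵇ≡false : ∀ {m n} → n ≤ m → (m <ᵇ n) ≡ false
  ≥⇒<ᵇ≡false {m} {n} p with m <ᵇ n in eq
  ... | false = refl
  ... | true = ⊥-elim (<⇒≱ (<ᵇ⇒< m n (subst T (sym eq) tt)) p)

  <ᵇ-cong-⇔ : ∀ {a b c d} → (a < b → c < d) → (c < d → a < b) → (a <ᵇ b) ≡ (c <ᵇ d)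
  <ᵇ-cong-⇔ {a} {b} f g with a <? b
  ... | yes p = trans (<⇒<ᵇ≡true p) (sym (<⇒<ᵇ≡true (f p)))
  ... | no p = trans (≥⇒<ᵇ≡false (≮⇒≥ p)) (sym (≥⇒<ᵇ≡false (≮⇒≥ (λ q → p (g q)))))

  <ᵇ-flip : ∀ {b c} → b ≢ c → (c <ᵇ b) ≡ not (b <ᵇ c)
  <ᵇ-flip {b} {c} ne with <-or-≥ b c
  ... | inj₁ h = trans (≥⇒<ᵇ≡false (<⇒≤ h)) (cong not (sym (<⇒<ᵇ≡true h)))
  ... | inj₂ h = trans (<⇒<ᵇ≡true (≤∧≢⇒< h (λ e → ne (sym e)))) (cong not (sym (≥⇒<ᵇ≡false h)))

  -- The shape 'x <ᵇ y ∧ rest' is how bounded lists are tested entrywise.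
  <ᵇ∧-head : ∀ x y {b} → T ((x <ᵇ y) ∧ b) → x < y
  <ᵇ∧-head x y p = <ᵇ⇒< x y (∧-fst p)

  <ᵇ∧-tail : ∀ x y {b} → T ((x <ᵇ y) ∧ b) → T b
  <ᵇ∧-tail x y p = ∧-snd {x <ᵇ y} p

  ≡ᵇ-refl : ∀ n → T (n ≡ᵇ n)
  ≡ᵇ-refl n = ≡⇒≡ᵇ n n refl

  ≢⇒not≡ᵇ : ∀ {m n} → m ≢ n → T (not (m ≡ᵇ n))
  ≢⇒not≡ᵇ {m} {n} ne with m ≡ᵇ n in eq
  ... | true = ne (≡ᵇ⇒≡ m n (subst T (sym eq) tt))
  ... | false = tt

  not≡ᵇ⇒≢ : ∀ {m n} → T (not (m ≡ᵇ n)) → m ≢ n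
  not≡ᵇ⇒≢ {m} {n} p refl with m ≡ᵇ m | ≡ᵇ-refl m
  ... | true | _ = p

  list== : List ℕ → List ℕ → Bool
  list== [] [] = true
  list== [] (_ ∷ _) = false
  list== (_ ∷ _) [] = false
  list== (x ∷ xs) (y ∷ ys) = (x ≡ᵇ y) ∧ list== xs ys

  list==-sound : ∀ xs ys → T (list== xs ys) → xs ≡ ys
  list==-sound [] [] _ = refl
  list==-sound (x ∷ xs) (y ∷ ys) p = cong₂ _∷_ (≡ᵇ⇒≡ x y (∧-fst p)) (list==-sound xs ys (∧-snd {x ≡ᵇ y} p))

  list==-complete : ∀ {xs ys} → xs ≡ ys → T (list== xs ys)
  list==-complete {xs} refl = refl== xs
    where
    refl== : ∀ xs → T (list== xs xs)
    refl== [] = tt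
    refl== (x ∷ xs) = ∧-intro (≡ᵇ-refl x) (refl== xs)


module FiniteTypes where

  -- A type is finite when it is in
  -- bijection with some Fin N; by the pigeonhole principle (stdlib's ↔⇒≡)
  -- this N is unique, so every count in this file is a bijection.

  open import Data.Nat using (ℕ; zero; suc; _+_; _*_)
  open import Data.Bool using (Bool; true; false; _∧_; not; T; if_then_else_)
  open import Data.Bool.Properties using (T-irrelevant)
  open import Data.Fin using (Fin) renaming (zero to fzero; suc to fsuc)
  open import Data.Fin.Properties using (+↔⊎; *↔×; 0↔⊥; 1↔⊤)
  open import Data.Fin.Permutation using (↔⇒≡)
  open import Data.List using (List)
  open import Data.Product using (Σ; _×_; _,_; proj₁)
  open import Data.Sum using (_⊎_; inj₁; inj₂)
  open import Data.Empty using (⊥-elim)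
  open import Data.Unit using (tt)
  open import Relation.Binary.PropositionalEquality
  open import Function.Bundles using (_↔_; mk↔ₛ′; Inverse)
  open import Function.Properties.Inverse using (↔-sym; ↔-trans)
  open import Data.Sum.Function.Propositional using (_⊎-↔_)
  open import Data.Product.Function.NonDependent.Propositional using (_×-↔_)
  open Booleans

  Finite : Set → Set
  Finite A = Σ ℕ λ N → Fin N ↔ A

  card : ∀ {A : Set} → Finite A → ℕ
  card = proj₁

  card-unique : ∀ {A : Set} (F : Finite A) {m} → Fin m ↔ A → m ≡ card F
  card-unique (N , e) h = ↔⇒≡ (↔-trans h (↔-sym e))

  card-↔ : ∀ {A B : Set} (F : Finite A) (G : Finite B) → A ↔ B → card F ≡ card G
  card-↔ (N , e) G h = card-unique G (↔-trans e h)

  finite-↔ : ∀ {A B : Set} → Finite A → A ↔ B → Finite B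
  finite-↔ (N , e) f = N , ↔-trans e f

  finite× : ∀ {A B : Set} → Finite A → Finite B → Finite (A × B)
  finite× (N , e) (M , f) = N * M , ↔-trans *↔× (e ×-↔ f)

  finite⊎ : ∀ {A B : Set} → Finite A → Finite B → Finite (A ⊎ B)
  finite⊎ (N , e) (M , f) = N + M , ↔-trans +↔⊎ (e ⊎-↔ f)

  -- Elements of a subtype cut out by a Boolean predicate are determined by
  -- their first component, since T b has at most one proof.
  witness-≡ : ∀ {X : Set} {Q : X → Bool} {x y : X} {p : T (Q x)} {q : T (Q y)} →
    x ≡ y → _≡_ {A = Σ X (λ x → T (Q x))} (x , p) (y , q)
  witness-≡ {x = x} refl = cong (x ,_) (T-irrelevant _ _)

  -- A decidable subset of Fin N is finite: peel off the element 0.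
  finite-FinSubset : ∀ N (Q : Fin N → Bool) → Finite (Σ (Fin N) (λ i → T (Q i)))
  finite-FinSubset zero Q = 0 , mk↔ₛ′ (λ ()) (λ { (() , _) }) (λ { (() , _) }) (λ ())
  finite-FinSubset (suc N) Q with finite-FinSubset N (λ i → Q (fsuc i))
  ... | K , e = _ , ↔-trans +↔⊎ (↔-trans (↔-sym (T↔Fin (Q fzero)) ⊎-↔ e) peel)
    where
    T↔Fin : ∀ b → T b ↔ Fin (if b then 1 else 0)
    T↔Fin true = ↔-sym 1↔⊤
    T↔Fin false = ↔-sym 0↔⊥
    peel : (T (Q fzero) ⊎ Σ (Fin N) (λ i → T (Q (fsuc i)))) ↔ Σ (Fin (suc N)) (λ i → T (Q i))
    peel = mk↔ₛ′ (λ { (inj₁ q) → fzero , q ; (inj₂ (i , q)) → fsuc i , q })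
                 (λ { (fzero , q) → inj₁ q ; (fsuc i , q) → inj₂ (i , q) })
                 (λ { (fzero , q) → refl ; (fsuc i , q) → refl })
                 (λ { (inj₁ q) → refl ; (inj₂ (i , q)) → refl })

  finite-subset : ∀ {A : Set} → Finite A → (Q : A → Bool) → Finite (Σ A (λ a → T (Q a)))
  finite-subset {A} (N , e) Q with finite-FinSubset N (λ i → Q (Inverse.to e i))
  ... | K , e2 = K , ↔-trans e2 transport
    where
    open Inverse e
    transport : Σ (Fin N) (λ i → T (Q (to i))) ↔ Σ A (λ a → T (Q a))
    transport = mk↔ₛ′ (λ (i , q) → to i , q)
      (λ (a , q) → from a , subst (λ z → T (Q z)) (sym (inverseˡ refl)) q)
      (λ (a , q) → witness-≡ (inverseˡ refl)) (λ (i , q) → witness-≡ (inverseʳ refl))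

  ListsWith : (List ℕ → Bool) → Set
  ListsWith P = Σ (List ℕ) (λ x → T (P x))

  restrict-↔ : ∀ {P Q : List ℕ → Bool} (f g : List ℕ → List ℕ) →
    (∀ x → T (P x) → T (Q (f x))) → (∀ y → T (Q y) → T (P (g y))) →
    (∀ x → T (P x) → g (f x) ≡ x) → (∀ y → T (Q y) → f (g y) ≡ y) →
    ListsWith P ↔ ListsWith Q
  restrict-↔ f g fp gq gf fg = mk↔ₛ′ (λ (x , p) → f x , fp x p) (λ (y , q) → g y , gq y q)
    (λ (y , q) → witness-≡ (fg y q)) (λ (x , p) → witness-≡ (gf x p))

  ListsWith-≐ : ∀ {P Q : List ℕ → Bool} → (∀ x → T (P x) → T (Q x)) → (∀ x → T (Q x) → T (P x)) →
    ListsWith P ↔ ListsWith Q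
  ListsWith-≐ f g = restrict-↔ (λ x → x) (λ x → x) f g (λ _ _ → refl) (λ _ _ → refl)

  ListsWith-false : ListsWith (λ _ → false) ↔ Fin 0
  ListsWith-false = mk↔ₛ′ (λ { (_ , ()) }) (λ ()) (λ ()) (λ { (_ , ()) })

  ListsWith-∧ : ∀ (A B : List ℕ → Bool) → ListsWith (λ x → A x ∧ B x) ↔ Σ (ListsWith A) (λ (x , _) → T (B x))
  ListsWith-∧ A B = mk↔ₛ′ (λ (x , p) → (x , ∧-fst p) , ∧-snd {A x} p) (λ ((x , p) , q) → x , ∧-intro p q)
    (λ ((x , p) , q) → pair-≡ x _ p _ q) (λ (x , p) → witness-≡ refl)
    where
    pair-≡ : ∀ x p p' q q' → _≡_ {A = Σ (ListsWith A) (λ (x , _) → T (B x))} ((x , p) , q) ((x , p') , q')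
    pair-≡ x p p' q q' rewrite T-irrelevant p p' | T-irrelevant q q' = refl

  ListsWith-split : ∀ (P a : List ℕ → Bool) →
    ListsWith P ↔ (ListsWith (λ t → P t ∧ a t) ⊎ ListsWith (λ t → P t ∧ not (a t)))
  ListsWith-split P a = mk↔ₛ′ to from to∘from from∘to
    where
    Split = ListsWith (λ t → P t ∧ a t) ⊎ ListsWith (λ t → P t ∧ not (a t))
    toWith : ∀ t → T (P t) → (b : Bool) → a t ≡ b → Split
    toWith t p true e = inj₁ (t , ∧-intro p (subst T (sym e) tt))
    toWith t p false e = inj₂ (t , ∧-intro p (subst (λ z → T (not z)) (sym e) tt))
    to : ListsWith P → Split
    to (t , p) = toWith t p (a t) refl
    from : Split → ListsWith P
    from (inj₁ (t , p)) = t , ∧-fst p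
    from (inj₂ (t , p)) = t , ∧-fst p
    from∘to : ∀ x → from (to x) ≡ x
    from∘to (t , p) = back (a t) refl
      where
      back : (b : Bool) (e : a t ≡ b) → from (toWith t p b e) ≡ (t , p)
      back true e = witness-≡ refl
      back false e = witness-≡ refl
    to∘from : ∀ y → to (from y) ≡ y
    to∘from (inj₁ (t , p)) = back (a t) refl
      where
      back : (b : Bool) (e : a t ≡ b) → toWith t (∧-fst p) b e ≡ inj₁ (t , p)
      back true e = cong inj₁ (witness-≡ refl)
      back false e = ⊥-elim (subst T e (∧-snd {P t} p))
    to∘from (inj₂ (t , p)) = back (a t) refl
      where
      back : (b : Bool) (e : a t ≡ b) → toWith t (∧-fst p) b e ≡ inj₂ (t , p)
      back true e = ⊥-elim (subst (λ z → T (not z)) e (∧-snd {P t} p))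
      back false e = cong inj₂ (witness-≡ refl)


module Codes where

  -- A code of length l at offset k is a list t₁ … t_l of naturals
  -- with t_i < k + i.  Codes at offset 0 and length n are the inversion
  -- sequences, in bijection with 𝔖ₙ (section LehmerCode); the bijection used
  -- there preserves the ascent pattern, so peak sets of permutations can be
  -- read off codes.

  open import Data.Nat using (ℕ; zero; suc; _+_; _<ᵇ_; _≤_; _<_; s≤s)
  open import Data.Nat.Properties
  open import Data.Bool using (Bool; true; false; _∧_; not; if_then_else_; T)
  open import Data.Bool.Properties using (∧-zeroʳ)
  open import Data.Fin using (Fin; toℕ; fromℕ<) renaming (zero to fzero; suc to fsuc)
  open import Data.Fin.Properties using (toℕ<n; toℕ-fromℕ<; fromℕ<-toℕ)
  open import Data.List using (List; []; _∷_; _++_; length; take; drop)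
  open import Data.Product using (_×_; _,_)
  open import Data.List.Relation.Unary.All using (All; []; _∷_)
  import Data.List.Relation.Unary.All as All
  open import Data.Empty using (⊥; ⊥-elim)
  open import Data.Unit using (tt)
  open import Relation.Binary.PropositionalEquality
  open import Function.Bundles using (_↔_; mk↔ₛ′)
  open import Function.Properties.Inverse using (↔-sym; ↔-refl)
  open Booleans
  open FiniteTypes

  isCode : ℕ → ℕ → List ℕ → Bool
  isCode k zero [] = true
  isCode k zero (_ ∷ _) = false
  isCode k (suc l) [] = false
  isCode k (suc l) (x ∷ xs) = (x <ᵇ suc k) ∧ isCode (suc k) l xs

  ascents : List ℕ → List Bool
  ascents [] = []
  ascents (x ∷ []) = []
  ascents (x ∷ y ∷ r) = (x <ᵇ y) ∷ ascents (y ∷ r)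

  -- Peak positions of an up/down word whose first letter sits at position
  -- pos, where up records whether the step into pos was an ascent: a peak is
  -- an ascent followed by a non-ascent.
  peaksAt : ℕ → Bool → List Bool → List ℕ
  peaksAt pos up [] = []
  peaksAt pos up (u ∷ us) = if up ∧ not u then pos ∷ peaksAt (suc pos) u us else peaksAt (suc pos) u us

  peakFree : Bool → List Bool → Bool
  peakFree up [] = true
  peakFree up (u ∷ us) = not (up ∧ not u) ∧ peakFree u us

  codePeaks : List ℕ → List ℕ
  codePeaks c = peaksAt 1 false (ascents c)

  isCodeWith : List ℕ → ℕ → List ℕ → Bool
  isCodeWith S n c = isCode 0 n c ∧ list== (codePeaks c) S

  Codes : List ℕ → ℕ → Set
  Codes S n = ListsWith (isCodeWith S n)

  isPeakFreeTail : ℕ → ℕ → List ℕ → Bool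
  isPeakFreeTail k l t = isCode k l t ∧ peakFree false (ascents t)

  -- Codes at offset k of length l without peaks; they are the possible tails
  -- after a prefix of length k in the recurrence for #Codes.
  PeakFreeTails : ℕ → ℕ → Set
  PeakFreeTails k l = ListsWith (isPeakFreeTail k l)

  -- All codes at offset k and length l: (k+1)(k+2)⋯(k+l) of them.
  finite-codes : ∀ k l → Finite (ListsWith (isCode k l))
  finite-codes k zero = 1 , mk↔ₛ′ (λ _ → [] , tt) (λ _ → fzero) (λ { ([] , tt) → refl }) (λ { fzero → refl ; (fsuc ()) })
  finite-codes k (suc l) = finite-↔ (finite× (suc k , ↔-refl) (finite-codes (suc k) l)) cons-↔
    where
    cons-↔ : (Fin (suc k) × ListsWith (isCode (suc k) l)) ↔ ListsWith (isCode k (suc l))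
    cons-↔ = mk↔ₛ′ (λ (i , (xs , p)) → toℕ i ∷ xs , ∧-intro (subst T (sym (<⇒<ᵇ≡true (toℕ<n i))) tt) p)
              (λ { ((x ∷ xs) , p) → fromℕ< (<ᵇ∧-head x (suc k) p) , (xs , ∧-snd {x <ᵇ suc k} p) })
              (λ { ((x ∷ xs) , p) → witness-≡ (cong (_∷ xs) (toℕ-fromℕ< _)) })
              (λ (i , (xs , p)) → cong₂ _,_ (fromℕ<-toℕ i _) (witness-≡ refl))

  finite-codesWith : ∀ k l (Q : List ℕ → Bool) → Finite (ListsWith (λ x → isCode k l x ∧ Q x))
  finite-codesWith k l Q = finite-↔ (finite-subset (finite-codes k l) (λ (x , _) → Q x)) (↔-sym (ListsWith-∧ (isCode k l) Q))

  finite-Codes : ∀ S n → Finite (Codes S n)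
  finite-Codes S n = finite-codesWith 0 n (λ c → list== (codePeaks c) S)

  finite-PeakFreeTails : ∀ k l → Finite (PeakFreeTails k l)
  finite-PeakFreeTails k l = finite-codesWith k l (λ t → peakFree false (ascents t))

  #Codes : List ℕ → ℕ → ℕ
  #Codes S n = card (finite-Codes S n)

  -- Total versions of init/last/head/tail (junk value on []).

  initL : List ℕ → List ℕ
  initL [] = []
  initL (x ∷ []) = []
  initL (x ∷ y ∷ r) = x ∷ initL (y ∷ r)

  lastL : List ℕ → ℕ
  lastL [] = 0
  lastL (x ∷ []) = x
  lastL (x ∷ y ∷ r) = lastL (y ∷ r)

  headL : List ℕ → ℕ
  headL [] = 0
  headL (x ∷ _) = x

  tailL : List ℕ → List ℕ
  tailL [] = []
  tailL (_ ∷ r) = r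

  initL-snoc : ∀ t x → initL (t ++ x ∷ []) ≡ t
  initL-snoc [] x = refl
  initL-snoc (y ∷ []) x = refl
  initL-snoc (y ∷ z ∷ t) x = cong (y ∷_) (initL-snoc (z ∷ t) x)

  lastL-snoc : ∀ t x → lastL (t ++ x ∷ []) ≡ x
  lastL-snoc [] x = refl
  lastL-snoc (y ∷ []) x = refl
  lastL-snoc (y ∷ z ∷ t) x = lastL-snoc (z ∷ t) x

  initLast : ∀ y t → initL (y ∷ t) ++ lastL (y ∷ t) ∷ [] ≡ y ∷ t
  initLast y [] = refl
  initLast y (z ∷ t) = cong (y ∷_) (initLast z t)

  take-++ : ∀ k (xs ys : List ℕ) → length xs ≡ k → take k (xs ++ ys) ≡ xs
  take-++ zero [] ys e = refl
  take-++ zero (x ∷ xs) ys ()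
  take-++ (suc k) [] ys ()
  take-++ (suc k) (x ∷ xs) ys e = cong (x ∷_) (take-++ k xs ys (suc-injective e))

  drop-++ : ∀ k (xs ys : List ℕ) → length xs ≡ k → drop k (xs ++ ys) ≡ ys
  drop-++ zero [] ys e = refl
  drop-++ zero (x ∷ xs) ys ()
  drop-++ (suc k) [] ys ()
  drop-++ (suc k) (x ∷ xs) ys e = drop-++ k xs ys (suc-injective e)

  isCode-length : ∀ k L t → T (isCode k L t) → length t ≡ L
  isCode-length k zero [] p = refl
  isCode-length k zero (x ∷ t) ()
  isCode-length k (suc L) [] ()
  isCode-length k (suc L) (x ∷ t) p = cong suc (isCode-length (suc k) L t (<ᵇ∧-tail x (suc k) p))

  isCode-weaken : ∀ k L t → T (isCode k L t) → T (isCode (suc k) L t)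
  isCode-weaken k zero [] p = tt
  isCode-weaken k (suc L) (x ∷ t) p = ∧-intro (<⇒<ᵇ (m<n⇒m<1+n (<ᵇ∧-head x (suc k) p))) (isCode-weaken (suc k) L t (∧-snd {x <ᵇ suc k} p))

  isCode-head : ∀ k L t → T (isCode k (suc L) t) → headL t < suc k
  isCode-head k L (x ∷ t) p = <ᵇ∧-head x (suc k) p

  isCode-last : ∀ k L t → T (isCode k (suc L) t) → lastL t < suc (k + L)
  isCode-last k zero (x ∷ []) p = subst (λ z → x < suc z) (sym (+-identityʳ k)) (<ᵇ∧-head x (suc k) p)
  isCode-last k zero (x ∷ y ∷ t) p = ⊥-elim (∧-snd {x <ᵇ suc k} p)
  isCode-last k (suc L) (x ∷ []) p = ⊥-elim (∧-snd {x <ᵇ suc k} p)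
  isCode-last k (suc L) (x ∷ y ∷ t) p = subst (λ z → lastL (y ∷ t) < suc z) (sym (+-suc k L)) (isCode-last (suc k) L (y ∷ t) (∧-snd {x <ᵇ suc k} p))

  isCode-snoc⁻ : ∀ k L t x → T (isCode k (suc L) (t ++ x ∷ [])) → T (isCode k L t) × x < suc (k + L)
  isCode-snoc⁻ k zero [] x p = tt , subst (λ z → x < suc z) (sym (+-identityʳ k)) (<ᵇ∧-head x (suc k) p)
  isCode-snoc⁻ k zero (y ∷ t) x p = ⊥-elim (absurd0 t (∧-snd {y <ᵇ suc k} p))
    where
    absurd0 : ∀ t → T (isCode (suc k) zero (t ++ x ∷ [])) → ⊥
    absurd0 [] ()
    absurd0 (_ ∷ _) ()
  isCode-snoc⁻ k (suc L) [] x p with ∧-snd {x <ᵇ suc k} p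
  ... | ()
  isCode-snoc⁻ k (suc L) (y ∷ t) x p with isCode-snoc⁻ (suc k) L t x (∧-snd {y <ᵇ suc k} p)
  ... | q , r = ∧-intro (∧-fst p) q , subst (λ z → x < suc z) (sym (+-suc k L)) r

  isCode-snoc⁺ : ∀ k L t x → T (isCode k L t) → x < suc (k + L) → T (isCode k (suc L) (t ++ x ∷ []))
  isCode-snoc⁺ k zero [] x p q = ∧-intro (<⇒<ᵇ (subst (λ z → x < suc z) (+-identityʳ k) q)) tt
  isCode-snoc⁺ k (suc L) (y ∷ t) x p q = ∧-intro (∧-fst p) (isCode-snoc⁺ (suc k) L t x (∧-snd {y <ᵇ suc k} p) (subst (λ z → x < suc z) (+-suc k L) q))

  isCode-take : ∀ j k l c → T (isCode j (k + l) c) → T (isCode j k (take k c))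
  isCode-take j zero l c p = tt
  isCode-take j (suc k) l [] ()
  isCode-take j (suc k) l (x ∷ c) p = ∧-intro (∧-fst p) (isCode-take (suc j) k l c (<ᵇ∧-tail x (suc j) p))

  isCode-drop : ∀ j k l c → T (isCode j (k + l) c) → T (isCode (j + k) l (drop k c))
  isCode-drop j zero l c p = subst (λ z → T (isCode z l c)) (sym (+-identityʳ j)) p
  isCode-drop j (suc k) l [] ()
  isCode-drop j (suc k) l (x ∷ c) p = subst (λ z → T (isCode z l (drop k c))) (sym (+-suc j k)) (isCode-drop (suc j) k l c (<ᵇ∧-tail x (suc j) p))

  isCode-++ : ∀ j k l xs ys → T (isCode j k xs) → T (isCode (j + k) l ys) → T (isCode j (k + l) (xs ++ ys))
  isCode-++ j zero l [] ys p q = subst (λ z → T (isCode z l ys)) (+-identityʳ j) q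
  isCode-++ j (suc k) l (x ∷ xs) ys p q = ∧-intro (∧-fst p) (isCode-++ (suc j) k l xs ys (<ᵇ∧-tail x (suc j) p) (subst (λ z → T (isCode z l ys)) (+-suc j k) q))

  ascents-snoc : ∀ y t x → ascents ((y ∷ t) ++ x ∷ []) ≡ ascents (y ∷ t) ++ (lastL (y ∷ t) <ᵇ x) ∷ []
  ascents-snoc y [] x = refl
  ascents-snoc y (z ∷ t) x = cong ((y <ᵇ z) ∷_) (ascents-snoc z t x)

  ascents-++ : ∀ y p z t → ascents ((y ∷ p) ++ (z ∷ t)) ≡ ascents (y ∷ p) ++ (lastL (y ∷ p) <ᵇ z) ∷ ascents (z ∷ t)
  ascents-++ y [] z t = refl
  ascents-++ y (w ∷ p) z t = cong ((y <ᵇ w) ∷_) (ascents-++ w p z t)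

  length-ascents : ∀ y p → length (ascents (y ∷ p)) ≡ length p
  length-ascents y [] = refl
  length-ascents y (w ∷ p) = cong suc (length-ascents w p)

  peaksAt-lower : ∀ pos up U → All (pos ≤_) (peaksAt pos up U)
  peaksAt-lower pos up [] = []
  peaksAt-lower pos up (u ∷ U) with up ∧ not u
  ... | true = ≤-refl ∷ All.map (λ q → <⇒≤ q) (peaksAt-lower (suc pos) u U)
  ... | false = All.map (λ q → <⇒≤ q) (peaksAt-lower (suc pos) u U)

  peaksAt-upper : ∀ pos up U → All (_< pos + length U) (peaksAt pos up U)
  peaksAt-upper pos up [] = []
  peaksAt-upper pos up (u ∷ U) with up ∧ not u
  ... | true = subst (pos <_) (sym (+-suc pos (length U))) (s≤s (m≤m+n pos (length U))) ∷ All.map (λ {x} q → subst (x <_) (sym (+-suc pos (length U))) q) (peaksAt-upper (suc pos) u U)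
  ... | false = All.map (λ {x} q → subst (x <_) (sym (+-suc pos (length U))) q) (peaksAt-upper (suc pos) u U)

  peakFree-false : ∀ u A → T (peakFree u A) → T (peakFree false A)
  peakFree-false u [] p = tt
  peakFree-false u (v ∷ A) p = ∧-intro tt (∧-snd {not (u ∧ not v)} p)

  peakFree-tail : ∀ up u A → T (peakFree up (u ∷ A)) → T (peakFree u A)
  peakFree-tail up u A p = ∧-snd {not (up ∧ not u)} p

  peakFree-drop : ∀ d r → T (peakFree false (ascents (d ∷ r))) → T (peakFree false (ascents r))
  peakFree-drop d [] w = tt
  peakFree-drop d (y ∷ r') w = peakFree-false _ (ascents (y ∷ r')) (peakFree-tail false _ (ascents (y ∷ r')) w)

  peakFree-init : ∀ up A b → T (peakFree up (A ++ b ∷ [])) → T (peakFree up A)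
  peakFree-init up [] b p = tt
  peakFree-init up (u ∷ A) b p = ∧-intro (∧-fst p) (peakFree-init u A b (∧-snd {not (up ∧ not u)} p))

  peakFree-snoc-ascent : ∀ up A → T (peakFree up A) → T (peakFree up (A ++ true ∷ []))
  peakFree-snoc-ascent up [] p = ∧-intro (subst T (sym (cong not (∧-zeroʳ up))) tt) tt
  peakFree-snoc-ascent up (u ∷ A) p = ∧-intro (∧-fst p) (peakFree-snoc-ascent u A (∧-snd {not (up ∧ not u)} p))


module Binomials where

  open import Data.Nat using (ℕ; zero; suc; _+_; _*_; _∸_; _<_)
  open import Data.Nat.Properties
  open import Data.Nat.Solver using (module +-*-Solver)
  open import Data.Product using (_,_)
  open import Relation.Binary.PropositionalEquality
  open +-*-Solver

  binom : ℕ → ℕ → ℕ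
  binom n zero = 1
  binom zero (suc k) = 0
  binom (suc n) (suc k) = binom n k + binom n (suc k)

  binom-above : ∀ n k → binom n (suc (n + k)) ≡ 0
  binom-above zero k = refl
  binom-above (suc n) k = cong₂ _+_ (binom-above n k) (trans (cong (binom n) (sym (+-suc (suc n) k))) (binom-above n (suc k)))

  binom-< : ∀ {n j} → n < j → binom n j ≡ 0
  binom-< {n} n<j with m≤n⇒∃[o]m+o≡n n<j
  ... | o , refl = binom-above n o

  binom-diag : ∀ n → binom n n ≡ 1
  binom-diag zero = refl
  binom-diag (suc n) = cong₂ _+_ (binom-diag n) (trans (cong (binom n) (sym (+-identityʳ (suc n)))) (binom-above n 0))

  binom-subdiag : ∀ n → binom (suc n) n ≡ suc n
  binom-subdiag zero = refl
  binom-subdiag (suc n) = trans (cong₂ _+_ (binom-subdiag n) (binom-diag (suc n))) (+-comm (suc n) 1)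

  binom-absorption : ∀ N j → suc j * binom (suc N) (suc j) ≡ suc N * binom N j
  binom-absorption zero zero = refl
  binom-absorption zero (suc j) = *-zeroʳ (suc (suc j))
  binom-absorption (suc M) zero = trans (*-identityˡ _) (trans (cong suc C[M+1,1]) (sym (*-identityʳ _)))
    where
    C[M+1,1] : binom (suc M) 1 ≡ suc M
    C[M+1,1] = trans (sym (*-identityˡ _)) (trans (binom-absorption M zero) (*-identityʳ _))
  binom-absorption (suc M) (suc j) = begin
      suc (suc j) * (binom (suc M) (suc j) + binom (suc M) (suc (suc j)))
    ≡⟨ *-distribˡ-+ (suc (suc j)) (binom (suc M) (suc j)) _ ⟩
      (binom (suc M) (suc j) + suc j * binom (suc M) (suc j)) + suc (suc j) * binom (suc M) (suc (suc j))
    ≡⟨ cong₂ (λ a b → (binom (suc M) (suc j) + a) + b) (binom-absorption M j) (binom-absorption M (suc j)) ⟩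
      (binom (suc M) (suc j) + suc M * binom M j) + suc M * binom M (suc j)
    ≡⟨ solve 4 (λ a b c m → (a :+ m :* b) :+ m :* c := a :+ m :* (b :+ c)) refl
         (binom (suc M) (suc j)) (binom M j) (binom M (suc j)) (suc M) ⟩
      binom (suc M) (suc j) + suc M * (binom M j + binom M (suc j))
    ∎
    where open ≡-Reasoning

  binom-absorption-∸ : ∀ n j → suc j * binom n (suc j) ≡ (n ∸ j) * binom n j
  binom-absorption-∸ n j = begin
      suc j * binom n (suc j)
    ≡⟨ sym (m+n∸m≡n (suc j * binom n j) _) ⟩
      (suc j * binom n j + suc j * binom n (suc j)) ∸ suc j * binom n j
    ≡⟨ cong (_∸ suc j * binom n j) (trans (sym (*-distribˡ-+ (suc j) (binom n j) _)) (binom-absorption n j)) ⟩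
      suc n * binom n j ∸ suc j * binom n j
    ≡⟨ sym (*-distribʳ-∸ (binom n j) (suc n) (suc j)) ⟩
      (n ∸ j) * binom n j
    ∎
    where open ≡-Reasoning


module PeakFreeTailCount where

  -- A peak-free code of length l+2
  -- either ends at its top value k+l+1 (drop the last entry), or starts at
  -- its top value k (drop the first entry), or avoids both and is then a
  -- peak-free code at offset k−1 (lemma avoidsTop-isCode).  Writing V(k, l)
  -- for the number of peak-free codes of length l at offset k, this gives
  -- V(k, l+2) = 2·V(k, l+1) + V(k−1, l+2), Pascal's rule in disguise.

  open import Data.Nat using (ℕ; zero; suc; _+_; _*_; _^_; _<ᵇ_; _≡ᵇ_; _≤_; _<_; s≤s; z≤n)
  open import Data.Nat.Properties
  open import Data.Nat.Solver using (module +-*-Solver)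
  open import Data.Bool using (Bool; true; false; _∧_; not; T)
  open import Data.Fin using (Fin; toℕ; fromℕ<)
  open import Data.Fin.Properties using (+↔⊎; toℕ<n; toℕ-fromℕ<; fromℕ<-toℕ)
  open import Data.List using (List; []; _∷_; _++_)
  open import Data.Product using (_,_; proj₁)
  open import Data.Sum using (_⊎_)
  open import Data.Empty using (⊥-elim)
  open import Data.Unit using (tt)
  open import Relation.Binary.PropositionalEquality
  open import Function.Bundles using (_↔_; mk↔ₛ′)
  open import Function.Properties.Inverse using (↔-sym; ↔-trans)
  open import Data.Sum.Function.Propositional using (_⊎-↔_)
  open Booleans
  open FiniteTypes
  open Codes
  open Binomials

  -- A peak-free code whose first step reaches the top value j must keep
  -- climbing to the top, so its last entry is maximal.

  climbsToTop : ∀ j L x r → T (isCode j (suc L) (x ∷ r)) → x ≡ j → T (peakFree true (ascents (x ∷ r))) → lastL (x ∷ r) ≡ j + L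
  climbsToTop j zero x [] p e v = trans e (sym (+-identityʳ j))
  climbsToTop j zero x (y ∷ r) p e v = ⊥-elim (∧-snd {x <ᵇ suc j} p)
  climbsToTop j (suc L) x [] p e v = ⊥-elim (∧-snd {x <ᵇ suc j} p)
  climbsToTop j (suc L) x (y ∷ r) p e v with x <ᵇ y in x<y?
  ... | false = ⊥-elim v
  ... | true = trans (climbsToTop (suc j) L y r (∧-snd {x <ᵇ suc j} p) y≡j+1 (∧-snd {true} v)) (sym (+-suc j L))
    where
    y≤j+1 : y < suc (suc j)
    y≤j+1 = <ᵇ∧-head y (suc (suc j)) (<ᵇ∧-tail x (suc j) p)
    x<y : x < y
    x<y = <ᵇ⇒< x y (subst T (sym x<y?) tt)
    y≡j+1 : y ≡ suc j
    y≡j+1 = ≤-antisym (≤-pred y≤j+1) (subst (λ z → suc z ≤ y) e x<y)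

  avoidsTop-isCode : ∀ k L d r → T (isCode (suc k) L r) → d ≤ k → T (peakFree false (ascents (d ∷ r))) →
       (∀ y r' → r ≡ y ∷ r' → lastL r ≢ k + L) → T (isCode k L r)
  avoidsTop-isCode k zero d [] p d≤k v lastNotTop = tt
  avoidsTop-isCode k (suc L) d (x ∷ r) p d≤k v lastNotTop with x <ᵇ suc k in x<k+1?
  ... | true = ∧-intro tt (avoidsTop-isCode (suc k) L x r (∧-snd {x <ᵇ suc (suc k)} p) (m≤n⇒m≤1+n (≤-pred (<ᵇ⇒< x (suc k) (subst T (sym x<k+1?) tt))))
                        (peakFree-false (d <ᵇ x) (ascents (x ∷ r)) (peakFree-tail false (d <ᵇ x) (ascents (x ∷ r)) v)) lastNotTop′)
    where
    lastNotTop′ : ∀ y r' → r ≡ y ∷ r' → lastL r ≢ suc k + L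
    lastNotTop′ y r' refl e = lastNotTop x r refl (trans e (sym (+-suc k L)))
  ... | false = ⊥-elim (lastNotTop x r refl (trans (climbsToTop (suc k) L x r p x≡k+1 climbs) (sym (+-suc k L))))
    where
    x≤k+1 : x < suc (suc k)
    x≤k+1 = <ᵇ∧-head x (suc (suc k)) p
    x≡k+1 : x ≡ suc k
    x≡k+1 = ≤-antisym (≤-pred x≤k+1) (≮⇒≥ (λ q → subst T x<k+1? (<⇒<ᵇ q)))
    d<x : (d <ᵇ x) ≡ true
    d<x = <⇒<ᵇ≡true (subst (d <_) (sym x≡k+1) (s≤s d≤k))
    climbs : T (peakFree true (ascents (x ∷ r)))
    climbs = subst (λ z → T (peakFree z (ascents (x ∷ r)))) d<x (peakFree-tail false (d <ᵇ x) (ascents (x ∷ r)) v)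

  endsAtTop : ℕ → ℕ → List ℕ → Bool
  endsAtTop k L t = lastL t ≡ᵇ (k + L)

  startsAtTop : ℕ → List ℕ → Bool
  startsAtTop k t = headL t ≡ᵇ k

  isPeakFreeTailBelow : ℕ → ℕ → List ℕ → Bool
  isPeakFreeTailBelow zero L t = false
  isPeakFreeTailBelow (suc k) L t = isPeakFreeTail k L t

  -- Tails ending at the top value: delete the final entry (the last step
  -- was an ascent, so no peak is lost or created).
  tails-endingAtTop : ∀ k l → ListsWith (λ t → isPeakFreeTail k (suc (suc l)) t ∧ endsAtTop k (suc l) t) ↔ PeakFreeTails k (suc l)
  tails-endingAtTop k l = restrict-↔ initL (λ t → t ++ (k + suc l) ∷ []) forth-ok back-ok back∘forth forth∘back
    where
    L = suc l
    forth-ok : ∀ t → T (isPeakFreeTail k (suc L) t ∧ endsAtTop k L t) → T (isPeakFreeTail k L (initL t))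
    forth-ok [] p = ⊥-elim p
    forth-ok (y ∷ t) p = ∧-intro codeInit peakFreeInit
      where
      e : lastL (y ∷ t) ≡ k + L
      e = ≡ᵇ⇒≡ _ _ (∧-snd {isPeakFreeTail k (suc L) (y ∷ t)} p)
      codeWhole : T (isCode k (suc L) (initL (y ∷ t) ++ lastL (y ∷ t) ∷ []))
      codeWhole = subst (λ z → T (isCode k (suc L) z)) (sym (initLast y t)) (∧-fst (∧-fst p))
      codeInit : T (isCode k L (initL (y ∷ t)))
      codeInit = proj₁ (isCode-snoc⁻ k L (initL (y ∷ t)) (lastL (y ∷ t)) codeWhole)
      peakFreeWhole : T (peakFree false (ascents (initL (y ∷ t) ++ lastL (y ∷ t) ∷ [])))
      peakFreeWhole = subst (λ z → T (peakFree false (ascents z))) (sym (initLast y t)) (∧-snd {isCode k (suc L) (y ∷ t)} (∧-fst p))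
      peakFreeInit : T (peakFree false (ascents (initL (y ∷ t))))
      peakFreeInit with initL (y ∷ t) | codeInit | peakFreeWhole
      ... | [] | () | _
      ... | z ∷ u | _ | w = peakFree-init false (ascents (z ∷ u)) _ (subst (λ q → T (peakFree false q)) (ascents-snoc z u _) w)
    back-ok : ∀ t → T (isPeakFreeTail k L t) → T (isPeakFreeTail k (suc L) (t ++ (k + L) ∷ []) ∧ endsAtTop k L (t ++ (k + L) ∷ []))
    back-ok [] p = ⊥-elim p
    back-ok (y ∷ t) p = ∧-intro (∧-intro codeSnoc peakFreeSnoc) (subst (λ z → T (z ≡ᵇ (k + L))) (sym (lastL-snoc (y ∷ t) _)) (≡ᵇ-refl (k + L)))
      where
      codeSnoc = isCode-snoc⁺ k L (y ∷ t) (k + L) (∧-fst p) ≤-refl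
      lastBelowTop : (lastL (y ∷ t) <ᵇ (k + L)) ≡ true
      lastBelowTop = <⇒<ᵇ≡true (subst (lastL (y ∷ t) <_) (sym (+-suc k l)) (isCode-last k l (y ∷ t) (∧-fst p)))
      peakFreeSnoc : T (peakFree false (ascents ((y ∷ t) ++ (k + L) ∷ [])))
      peakFreeSnoc = subst (λ q → T (peakFree false q)) (sym (trans (ascents-snoc y t (k + L)) (cong (λ b → ascents (y ∷ t) ++ b ∷ []) lastBelowTop)))
              (peakFree-snoc-ascent false (ascents (y ∷ t)) (∧-snd {isCode k L (y ∷ t)} p))
    back∘forth : ∀ t → T (isPeakFreeTail k (suc L) t ∧ endsAtTop k L t) → initL t ++ (k + L) ∷ [] ≡ t
    back∘forth [] p = ⊥-elim p
    back∘forth (y ∷ t) p = trans (cong (λ z → initL (y ∷ t) ++ z ∷ []) (sym e)) (initLast y t)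
      where
      e : lastL (y ∷ t) ≡ k + L
      e = ≡ᵇ⇒≡ _ _ (∧-snd {isPeakFreeTail k (suc L) (y ∷ t)} p)
    forth∘back : ∀ t → T (isPeakFreeTail k L t) → initL (t ++ (k + L) ∷ []) ≡ t
    forth∘back t _ = initL-snoc t _

  tails-startingAtTop : ∀ k l → ListsWith (λ t → (isPeakFreeTail k (suc (suc l)) t ∧ not (endsAtTop k (suc l) t)) ∧ startsAtTop k t) ↔ PeakFreeTails k (suc l)
  tails-startingAtTop k l = restrict-↔ tailL (k ∷_) forth-ok back-ok back∘forth forth∘back
    where
    L = suc l
    forth-ok : ∀ t → T ((isPeakFreeTail k (suc L) t ∧ not (endsAtTop k L t)) ∧ startsAtTop k t) → T (isPeakFreeTail k L (tailL t))
    forth-ok [] p = ⊥-elim p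
    forth-ok (d ∷ r) p = ∧-intro codeTail peakFreeTail
      where
      code = ∧-fst (∧-fst (∧-fst p))
      peakFreeWhole : T (peakFree false (ascents (d ∷ r)))
      peakFreeWhole = ∧-snd {isCode k (suc L) (d ∷ r)} (∧-fst (∧-fst p))
      notEndsTop : T (not (endsAtTop k L (d ∷ r)))
      notEndsTop = ∧-snd {isPeakFreeTail k (suc L) (d ∷ r)} (∧-fst p)
      lastNotTop : ∀ y r' → r ≡ y ∷ r' → lastL r ≢ k + L
      lastNotTop y r' refl e = not≡ᵇ⇒≢ notEndsTop e
      codeTail : T (isCode k L r)
      codeTail = avoidsTop-isCode k L d r (<ᵇ∧-tail d (suc k) code) (≤-pred (<ᵇ∧-head d (suc k) code)) peakFreeWhole lastNotTop
      peakFreeTail : T (peakFree false (ascents r))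
      peakFreeTail = peakFree-drop d r peakFreeWhole
    back-ok : ∀ t → T (isPeakFreeTail k L t) → T ((isPeakFreeTail k (suc L) (k ∷ t) ∧ not (endsAtTop k L (k ∷ t))) ∧ startsAtTop k (k ∷ t))
    back-ok [] p = ⊥-elim p
    back-ok (y ∷ t) p = ∧-intro (∧-intro (∧-intro (∧-intro {k <ᵇ suc k} (<⇒<ᵇ (≤-refl {suc k})) (isCode-weaken k L (y ∷ t) (∧-fst {isCode k L (y ∷ t)} p))) peakFreeCons) notEndsTop) (≡ᵇ-refl k)
      where
      y≤k : y ≤ k
      y≤k = ≤-pred (isCode-head k l (y ∷ t) (∧-fst p))
      peakFreeCons : T (peakFree false (ascents (k ∷ y ∷ t)))
      peakFreeCons = subst (λ b → T (peakFree false (b ∷ ascents (y ∷ t)))) (sym (≥⇒<ᵇ≡false y≤k)) (∧-intro tt (∧-snd {isCode k L (y ∷ t)} p))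
      notEndsTop : T (not (endsAtTop k L (k ∷ y ∷ t)))
      notEndsTop = ≢⇒not≡ᵇ (λ e → <⇒≢ (isCode-last k l (y ∷ t) (∧-fst p)) (trans e (+-suc k l)))
    back∘forth : ∀ t → T ((isPeakFreeTail k (suc L) t ∧ not (endsAtTop k L t)) ∧ startsAtTop k t) → k ∷ tailL t ≡ t
    back∘forth [] p = ⊥-elim p
    back∘forth (d ∷ r) p = cong (_∷ r) (sym (≡ᵇ⇒≡ d k (∧-snd {isPeakFreeTail k (suc L) (d ∷ r) ∧ not (endsAtTop k L (d ∷ r))} p)))
    forth∘back : ∀ t → T (isPeakFreeTail k L t) → tailL (k ∷ t) ≡ t
    forth∘back t _ = refl

  tails-awayFromTop : ∀ k l → ListsWith (λ t → (isPeakFreeTail k (suc (suc l)) t ∧ not (endsAtTop k (suc l) t)) ∧ not (startsAtTop k t)) ↔ ListsWith (isPeakFreeTailBelow k (suc (suc l)))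
  tails-awayFromTop k l = ListsWith-≐ (forth-ok k) (back-ok k)
    where
    L = suc l
    forth-ok : ∀ k t → T ((isPeakFreeTail k (suc L) t ∧ not (endsAtTop k L t)) ∧ not (startsAtTop k t)) → T (isPeakFreeTailBelow k (suc L) t)
    forth-ok k [] p = ⊥-elim p
    forth-ok k (d ∷ r) p = below k refl
      where
      code = ∧-fst (∧-fst (∧-fst p))
      peakFreeWhole : T (peakFree false (ascents (d ∷ r)))
      peakFreeWhole = ∧-snd {isCode k (suc L) (d ∷ r)} (∧-fst (∧-fst p))
      notEndsTop : T (not (endsAtTop k L (d ∷ r)))
      notEndsTop = ∧-snd {isPeakFreeTail k (suc L) (d ∷ r)} (∧-fst p)
      d≢k : d ≢ k
      d≢k = not≡ᵇ⇒≢ (∧-snd {isPeakFreeTail k (suc L) (d ∷ r) ∧ not (endsAtTop k L (d ∷ r))} p)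
      lastNotTop : ∀ y r' → r ≡ y ∷ r' → lastL r ≢ k + L
      lastNotTop y r' refl e = not≡ᵇ⇒≢ notEndsTop e
      d≤k : d ≤ k
      d≤k = ≤-pred (<ᵇ∧-head d (suc k) code)
      codeTail : T (isCode k L r)
      codeTail = avoidsTop-isCode k L d r (<ᵇ∧-tail d (suc k) code) d≤k peakFreeWhole lastNotTop
      below : ∀ k' → k' ≡ k → T (isPeakFreeTailBelow k' (suc L) (d ∷ r))
      below zero e = d≢k (≤-antisym d≤k (subst (_≤ d) e z≤n))
      below (suc k') refl = ∧-intro (∧-intro (<⇒<ᵇ (≤∧≢⇒< d≤k d≢k)) codeTail) peakFreeWhole
    back-ok : ∀ k t → T (isPeakFreeTailBelow k (suc L) t) → T ((isPeakFreeTail k (suc L) t ∧ not (endsAtTop k L t)) ∧ not (startsAtTop k t))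
    back-ok zero t ()
    back-ok (suc k) [] p = ⊥-elim p
    back-ok (suc k) (d ∷ r) p = ∧-intro (∧-intro (∧-intro (isCode-weaken k (suc L) (d ∷ r) (∧-fst p)) (∧-snd {isCode k (suc L) (d ∷ r)} p)) notEndsTop) notStartsTop
      where
      notEndsTop : T (not (endsAtTop (suc k) L (d ∷ r)))
      notEndsTop = ≢⇒not≡ᵇ (λ e → <⇒≢ (isCode-last k L (d ∷ r) (∧-fst p)) e)
      notStartsTop : T (not (startsAtTop (suc k) (d ∷ r)))
      notStartsTop = ≢⇒not≡ᵇ (λ e → <⇒≢ (isCode-head k L (d ∷ r) (∧-fst p)) e)

  PeakFreeTails-split : ∀ k l → PeakFreeTails k (suc (suc l)) ↔ (PeakFreeTails k (suc l) ⊎ (PeakFreeTails k (suc l) ⊎ ListsWith (isPeakFreeTailBelow k (suc (suc l)))))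
  PeakFreeTails-split k l = ↔-trans (ListsWith-split (isPeakFreeTail k (suc (suc l))) (endsAtTop k (suc l)))
    (tails-endingAtTop k l ⊎-↔ ↔-trans (ListsWith-split (λ t → isPeakFreeTail k (suc (suc l)) t ∧ not (endsAtTop k (suc l) t)) (startsAtTop k)) (tails-startingAtTop k l ⊎-↔ tails-awayFromTop k l))

  PeakFreeTails-recurrence : ∀ k l {a b} → Fin a ↔ PeakFreeTails k (suc l) →
    Fin b ↔ ListsWith (isPeakFreeTailBelow k (suc (suc l))) → Fin (a + (a + b)) ↔ PeakFreeTails k (suc (suc l))
  PeakFreeTails-recurrence k l A B =
    ↔-trans (↔-trans +↔⊎ (A ⊎-↔ ↔-trans +↔⊎ (A ⊎-↔ B))) (↔-sym (PeakFreeTails-split k l))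

  PeakFreeTails-single : ∀ k → Fin (suc k) ↔ PeakFreeTails k 1
  PeakFreeTails-single k = mk↔ₛ′ (λ i → toℕ i ∷ [] , ∧-intro (∧-intro (<⇒<ᵇ (toℕ<n i)) tt) tt)
    (λ { ([] , ()) ; ((x ∷ []) , p) → fromℕ< (<ᵇ∧-head x (suc k) (∧-fst {isCode k 1 (x ∷ [])} p)) ; ((x ∷ y ∷ r) , p) → ⊥-elim (<ᵇ∧-tail x (suc k) (∧-fst {isCode k 1 (x ∷ y ∷ r)} p)) })
    (λ { ([] , ()) ; ((x ∷ []) , p) → witness-≡ (cong (_∷ []) (toℕ-fromℕ< _)) ; ((x ∷ y ∷ r) , p) → ⊥-elim (<ᵇ∧-tail x (suc k) (∧-fst {isCode k 1 (x ∷ y ∷ r)} p)) })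
    (λ i → fromℕ<-toℕ i _)

  PeakFreeTails-count : ∀ l k → Fin (binom (k + suc l) k * 2 ^ l) ↔ PeakFreeTails k (suc l)
  PeakFreeTails-count zero k = subst (λ z → Fin z ↔ PeakFreeTails k 1) (sym count) (PeakFreeTails-single k)
    where
    count : binom (k + 1) k * 1 ≡ suc k
    count = trans (*-identityʳ _) (trans (cong (λ z → binom z k) (+-comm k 1)) (binom-subdiag k))
  PeakFreeTails-count (suc l) zero = subst (λ z → Fin z ↔ PeakFreeTails 0 (suc (suc l))) (sym count)
    (PeakFreeTails-recurrence 0 l (PeakFreeTails-count l 0) (↔-sym ListsWith-false))
    where
    count : 1 * (2 * 2 ^ l) ≡ 1 * 2 ^ l + (1 * 2 ^ l + 0)
    count = solve 1 (λ x → con 1 :* (con 2 :* x) := con 1 :* x :+ (con 1 :* x :+ con 0)) refl (2 ^ l)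
      where open +-*-Solver
  PeakFreeTails-count (suc l) (suc k) = subst (λ z → Fin z ↔ PeakFreeTails (suc k) (suc (suc l))) (sym count)
    (PeakFreeTails-recurrence (suc k) l (PeakFreeTails-count l (suc k)) (PeakFreeTails-count (suc l) k))
    where
    -- Pascal's rule C(k+l+3, k+1) = C(k+l+2, k+1) + C(k+l+2, k), times 2^(l+1).
    count : binom (suc k + suc (suc l)) (suc k) * 2 ^ suc l
          ≡ binom (suc k + suc l) (suc k) * 2 ^ l + (binom (suc k + suc l) (suc k) * 2 ^ l + binom (k + suc (suc l)) k * 2 ^ suc l)
    count = begin
        binom (suc k + suc (suc l)) (suc k) * 2 ^ suc l
      ≡⟨ solve 3 (λ x y z → (y :+ x) :* (con 2 :* z) := x :* z :+ (x :* z :+ y :* (con 2 :* z))) refl X Y (2 ^ l) ⟩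
        X * 2 ^ l + (X * 2 ^ l + Y * 2 ^ suc l)
      ≡⟨ cong (λ w → binom w (suc k) * 2 ^ l + (binom w (suc k) * 2 ^ l + Y * 2 ^ suc l)) (+-suc k (suc l)) ⟩
        binom (suc k + suc l) (suc k) * 2 ^ l + (binom (suc k + suc l) (suc k) * 2 ^ l + Y * 2 ^ suc l)
      ∎
      where
      open ≡-Reasoning
      open +-*-Solver
      X = binom (k + suc (suc l)) (suc k)
      Y = binom (k + suc (suc l)) k

  -- Codes with no peak are exactly the peak-free tails at offset 0.
  #Codes-[] : ∀ l → #Codes [] (suc l) ≡ 2 ^ l
  #Codes-[] l = trans (card-↔ (finite-Codes [] (suc l)) (finite-PeakFreeTails 0 (suc l)) no-peaks)
    (sym (card-unique (finite-PeakFreeTails 0 (suc l)) (subst (λ w → Fin w ↔ PeakFreeTails 0 (suc l)) (*-identityˡ _) (PeakFreeTails-count l 0))))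
    where
    peaksAt-[] : ∀ pos up U → list== (peaksAt pos up U) [] ≡ peakFree up U
    peaksAt-[] pos up [] = refl
    peaksAt-[] pos true (false ∷ U) = refl
    peaksAt-[] pos true (true ∷ U) = peaksAt-[] (suc pos) true U
    peaksAt-[] pos false (u ∷ U) = peaksAt-[] (suc pos) u U
    same : ∀ c → isCodeWith [] (suc l) c ≡ isPeakFreeTail 0 (suc l) c
    same c = cong (isCode 0 (suc l) c ∧_) (peaksAt-[] 1 false (ascents c))
    no-peaks : Codes [] (suc l) ↔ PeakFreeTails 0 (suc l)
    no-peaks = ListsWith-≐ (λ c → subst T (same c)) (λ c → subst T (sym (same c)))


module PeakRecurrence where

  -- Let S = S₁ ++ [k+1] with every element of S₁
  -- below k.  Cutting a code c of length n = k + l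
  -- (l ≥ 1) after position k, c = p ++ t, the peaks of c are those of p
  -- (all < k) followed by the peaks Z at positions ≥ k; and t is peak-free
  -- exactly when Z is [], [k] or [k+1] (NewPeaks).  Hence the codes whose
  -- prefix has peak set S₁ and whose tail is peak-free, which are in
  -- bijection with Codes S₁ k × PeakFreeTails k l, fall into three classes
  -- according to Z, namely the codes with peak set S, S₁ and S₁ ++ [k]:
  --   #Codes S n + #Codes S₁ n + #Codes (S₁ ++ [k]) n = #Codes S₁ k · #PeakFreeTails k l.

  open import Data.Nat using (ℕ; suc; _+_; _<ᵇ_; _≤_; _<_)
  open import Data.Nat.Properties
  open import Data.Bool using (Bool; true; false; _∧_; not; if_then_else_; T)
  open import Data.List using (List; []; _∷_; _++_; length; take; drop)
  open import Data.List.Properties using (take++drop≡id; ++-identityʳ; ∷-injectiveˡ; ∷-injectiveʳ; ∷-injective; ++-cancelˡ)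
  open import Data.List.Relation.Unary.All using (All; []; _∷_)
  import Data.List.Relation.Unary.All as All
  open import Data.Product using (Σ; _×_; _,_; proj₁; proj₂)
  open import Data.Sum using (_⊎_; inj₁; inj₂)
  open import Data.Empty using (⊥; ⊥-elim)
  open import Data.Unit using (tt)
  open import Relation.Binary.PropositionalEquality
  open import Function.Bundles using (_↔_; mk↔ₛ′)
  open import Function.Properties.Inverse using (↔-sym; ↔-trans; ↔-refl)
  open import Data.Sum.Function.Propositional using (_⊎-↔_)
  open Booleans
  open FiniteTypes
  open Codes

  lastAscent : Bool → List Bool → Bool
  lastAscent up [] = up
  lastAscent up (u ∷ us) = lastAscent u us

  peaksAt-++ : ∀ pos up U W → peaksAt pos up (U ++ W) ≡ peaksAt pos up U ++ peaksAt (pos + length U) (lastAscent up U) W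
  peaksAt-++ pos up [] W = cong (λ z → peaksAt z up W) (sym (+-identityʳ pos))
  peaksAt-++ pos up (u ∷ U) W with up ∧ not u
  ... | true = cong (pos ∷_) (trans (peaksAt-++ (suc pos) u U W) (cong (λ z → peaksAt (suc pos) u U ++ peaksAt z (lastAscent u U) W) (sym (+-suc pos (length U)))))
  ... | false = trans (peaksAt-++ (suc pos) u U W) (cong (λ z → peaksAt (suc pos) u U ++ peaksAt z (lastAscent u U) W) (sym (+-suc pos (length U))))

  peakFree⇒peaksAt-[] : ∀ pos up U → T (peakFree up U) → peaksAt pos up U ≡ []
  peakFree⇒peaksAt-[] pos up [] v = refl
  peakFree⇒peaksAt-[] pos up (u ∷ U) v with up ∧ not u
  ... | true = ⊥-elim v
  ... | false = peakFree⇒peaksAt-[] (suc pos) u U (∧-snd {true} v)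

  peaksAt-[]⇒peakFree : ∀ pos up U → peaksAt pos up U ≡ [] → T (peakFree up U)
  peaksAt-[]⇒peakFree pos up [] e = tt
  peaksAt-[]⇒peakFree pos up (u ∷ U) e with up ∧ not u
  ... | true = ⊥-elim (case e)
    where
    case : pos ∷ peaksAt (suc pos) u U ≡ [] → ⊥
    case ()
  ... | false = ∧-intro tt (peaksAt-[]⇒peakFree (suc pos) u U e)

  ++-split-unique : ∀ k (A B C D : List ℕ) → All (_< k) A → All (_< k) C → All (k ≤_) B → All (k ≤_) D →
    A ++ B ≡ C ++ D → A ≡ C × B ≡ D
  ++-split-unique k [] B [] D _ _ _ _ e = refl , e
  ++-split-unique k [] (b ∷ B) (c ∷ C) D _ (c< ∷ _) (kb ∷ _) _ e = ⊥-elim (<⇒≱ (subst (_< k) (sym (∷-injectiveˡ e)) c<) kb)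
  ++-split-unique k (a ∷ A) B [] (d ∷ D) (a< ∷ _) _ _ (kd ∷ _) e = ⊥-elim (<⇒≱ (subst (_< k) (∷-injectiveˡ e) a<) kd)
  ++-split-unique k (a ∷ A) B (c ∷ C) D (_ ∷ pa) (_ ∷ pc) pb pd e with ∷-injective e
  ... | refl , e' = let (x , y) = ++-split-unique k A B C D pa pc pb pd e' in cong (a ∷_) x , y
  ++-split-unique k (a ∷ A) B [] [] _ _ _ _ ()

  -- The peak lists that may appear at positions ≥ k when the tail after
  -- position k is peak-free: a peak can only occur at the junction.
  NewPeaks : ℕ → List ℕ → Set
  NewPeaks k Z = Z ≡ [] ⊎ (Z ≡ k ∷ [] ⊎ Z ≡ suc k ∷ [])

  -- The word b ∷ A records the step across the junction at position k
  -- followed by the tail's own word A; A is peak-free iff the peaks from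
  -- position k on are one of the NewPeaks shapes.
  peakFree⇒NewPeaks : ∀ k stepIn b A → T (peakFree false A) → NewPeaks k (peaksAt k stepIn (b ∷ A))
  peakFree⇒NewPeaks k stepIn b [] v with stepIn ∧ not b
  ... | true = inj₂ (inj₁ refl)
  ... | false = inj₁ refl
  peakFree⇒NewPeaks k stepIn b (a ∷ A) v rewrite peakFree⇒peaksAt-[] (suc (suc k)) a A (∧-snd {true} v) = cases stepIn b a
    where
    cases : ∀ stepIn b a → NewPeaks k (if stepIn ∧ not b then k ∷ (if b ∧ not a then suc k ∷ [] else []) else (if b ∧ not a then suc k ∷ [] else []))
    cases true true true = inj₁ refl
    cases true true false = inj₂ (inj₂ refl)
    cases true false a = inj₂ (inj₁ refl)
    cases false true true = inj₁ refl
    cases false true false = inj₂ (inj₂ refl)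
    cases false false a = inj₁ refl

  NewPeaks⇒peakFree : ∀ k stepIn b A → NewPeaks k (peaksAt k stepIn (b ∷ A)) → T (peakFree false A)
  NewPeaks⇒peakFree k stepIn b [] z = tt
  NewPeaks⇒peakFree k stepIn b (a ∷ A) z = ∧-intro tt (peaksAt-[]⇒peakFree (suc (suc k)) a A (cases stepIn b a (peaksAt (suc (suc k)) a A) (peaksAt-lower (suc (suc k)) a A) z))
    where
    tooLow : ∀ {x} R → All (suc (suc k) ≤_) (x ∷ R) → x ≡ k ⊎ x ≡ suc k → ⊥
    tooLow R (q ∷ _) (inj₁ refl) = 1+n≰n (≤-trans (n≤1+n _) q)
    tooLow R (q ∷ _) (inj₂ refl) = 1+n≰n q
    cases : ∀ stepIn b a R → All (suc (suc k) ≤_) R →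
         NewPeaks k (if stepIn ∧ not b then k ∷ (if b ∧ not a then suc k ∷ R else R) else (if b ∧ not a then suc k ∷ R else R)) → R ≡ []
    cases true true true [] _ _ = refl
    cases true true true (x ∷ R) h (inj₁ ())
    cases true true true (x ∷ R) h (inj₂ (inj₁ e)) = ⊥-elim (tooLow R h (inj₁ (∷-injectiveˡ e)))
    cases true true true (x ∷ R) h (inj₂ (inj₂ e)) = ⊥-elim (tooLow R h (inj₂ (∷-injectiveˡ e)))
    cases true true false R h (inj₁ ())
    cases true true false R h (inj₂ (inj₁ e)) = ⊥-elim (1+n≢n (∷-injectiveˡ e))
    cases true true false R h (inj₂ (inj₂ e)) = ∷-injectiveʳ e
    cases true false a R h (inj₁ ())
    cases true false a R h (inj₂ (inj₁ e)) = ∷-injectiveʳ e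
    cases true false a R h (inj₂ (inj₂ e)) = ⊥-elim (1+n≢n (sym (∷-injectiveˡ e)))
    cases false true true [] _ _ = refl
    cases false true true (x ∷ R) h (inj₁ ())
    cases false true true (x ∷ R) h (inj₂ (inj₁ e)) = ⊥-elim (tooLow R h (inj₁ (∷-injectiveˡ e)))
    cases false true true (x ∷ R) h (inj₂ (inj₂ e)) = ⊥-elim (tooLow R h (inj₂ (∷-injectiveˡ e)))
    cases false true false R h (inj₁ ())
    cases false true false R h (inj₂ (inj₁ e)) = ⊥-elim (1+n≢n (∷-injectiveˡ e))
    cases false true false R h (inj₂ (inj₂ e)) = ∷-injectiveʳ e
    cases false false a [] _ _ = refl
    cases false false a (x ∷ R) h (inj₁ ())
    cases false false a (x ∷ R) h (inj₂ (inj₁ e)) = ⊥-elim (tooLow R h (inj₁ (∷-injectiveˡ e)))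
    cases false false a (x ∷ R) h (inj₂ (inj₂ e)) = ⊥-elim (tooLow R h (inj₂ (∷-injectiveˡ e)))

  codePeaks-++ : ∀ y p z t → codePeaks ((y ∷ p) ++ (z ∷ t)) ≡
    codePeaks (y ∷ p) ++ peaksAt (suc (length p)) (lastAscent false (ascents (y ∷ p))) ((lastL (y ∷ p) <ᵇ z) ∷ ascents (z ∷ t))
  codePeaks-++ y p z t = trans (cong (peaksAt 1 false) (ascents-++ y p z t))
    (trans (peaksAt-++ 1 false (ascents (y ∷ p)) ((lastL (y ∷ p) <ᵇ z) ∷ ascents (z ∷ t))) (cong (λ w → codePeaks (y ∷ p) ++ peaksAt (suc w) (lastAscent false (ascents (y ∷ p))) ((lastL (y ∷ p) <ᵇ z) ∷ ascents (z ∷ t))) (length-ascents y p)))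

  module Decomposition (S1 : List ℕ) (k0 l0 : ℕ) (S1<k : All (_< suc k0) S1) where
    k = suc k0
    l = suc l0
    n = k + l

    record Decomposed (c : List ℕ) : Set where
      field
        Z : List ℕ
        peaks-cut : codePeaks c ≡ codePeaks (take k c) ++ Z
        prefixPeaks-below : All (_< k) (codePeaks (take k c))
        junctionPeaks-above : All (k ≤_) Z
        peakFreeTail⇒NewPeaks : T (peakFree false (ascents (drop k c))) → NewPeaks k Z
        NewPeaks⇒peakFreeTail : NewPeaks k Z → T (peakFree false (ascents (drop k c)))

    decompose : ∀ c → T (isCode 0 n c) → Decomposed c
    decompose [] ()
    decompose (y ∷ c') code = atCut (take k0 c') (drop k0 c') refl refl (isCode-length 1 k0 (take k0 c') (isCode-take 1 k0 l c' (<ᵇ∧-tail y 1 code)))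
                                (isCode-drop 1 k0 l c' (<ᵇ∧-tail y 1 code))
      where
      atCut : ∀ p' t → take k0 c' ≡ p' → drop k0 c' ≡ t → length p' ≡ k0 → T (isCode (1 + k0) l t) → Decomposed (y ∷ c')
      atCut p' [] _ _ _ ()
      atCut p' (z ∷ t') ep et lp okt = record
        { Z = junctionPeaks
        ; peaks-cut = peaks-cut′
        ; prefixPeaks-below = subst (λ w → All (_< k) (codePeaks w)) (sym (cong (y ∷_) ep)) prefixPeaks-below′
        ; junctionPeaks-above = subst (λ w → All (w ≤_) junctionPeaks) (cong suc lp) (peaksAt-lower (suc (length p')) stepIn junctionWord)
        ; peakFreeTail⇒NewPeaks = λ v → subst (λ w → NewPeaks w junctionPeaks) (cong suc lp) (peakFree⇒NewPeaks (suc (length p')) stepIn stepAcross (ascents (z ∷ t')) (subst (λ w → T (peakFree false (ascents w))) et v))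
        ; NewPeaks⇒peakFreeTail = λ zs → subst (λ w → T (peakFree false (ascents w))) (sym et) (NewPeaks⇒peakFree (suc (length p')) stepIn stepAcross (ascents (z ∷ t')) (subst (λ w → NewPeaks w junctionPeaks) (sym (cong suc lp)) zs))
        }
        where
        stepIn = lastAscent false (ascents (y ∷ p'))
        stepAcross = lastL (y ∷ p') <ᵇ z
        junctionWord = stepAcross ∷ ascents (z ∷ t')
        junctionPeaks = peaksAt (suc (length p')) stepIn junctionWord
        cut : y ∷ c' ≡ (y ∷ p') ++ (z ∷ t')
        cut = cong (y ∷_) (trans (sym (take++drop≡id k0 c')) (cong₂ _++_ ep et))
        peaks-cut′ : codePeaks (y ∷ c') ≡ codePeaks (take k (y ∷ c')) ++ junctionPeaks
        peaks-cut′ = trans (cong codePeaks cut) (trans (codePeaks-++ y p' z t') (cong (λ w → codePeaks w ++ junctionPeaks) (sym (cong (y ∷_) ep))))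
        prefixPeaks-below′ : All (_< k) (codePeaks (y ∷ p'))
        prefixPeaks-below′ = subst (λ w → All (_< w) (codePeaks (y ∷ p'))) (cong suc (trans (length-ascents y p') lp)) (peaksAt-upper 1 false (ascents (y ∷ p')))

    isSplitCode : List ℕ → Bool
    isSplitCode c = isCode 0 n c ∧ (list== (codePeaks (take k c)) S1 ∧ peakFree false (ascents (drop k c)))

    splitCodes-↔-product : ListsWith isSplitCode ↔ (Codes S1 k × PeakFreeTails k l)
    splitCodes-↔-product = mk↔ₛ′ to from to∘from from∘to
      where
      to : ListsWith isSplitCode → Codes S1 k × PeakFreeTails k l
      to (c , w) = (take k c , ∧-intro (isCode-take 0 k l c (∧-fst w)) (∧-fst (∧-snd {isCode 0 n c} w))) ,
                   (drop k c , ∧-intro (isCode-drop 0 k l c (∧-fst w)) (∧-snd {list== (codePeaks (take k c)) S1} (∧-snd {isCode 0 n c} w)))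
      prefixLength : ∀ p → T (isCodeWith S1 k p) → length p ≡ k
      prefixLength p q = isCode-length 0 k p (∧-fst q)
      from : Codes S1 k × PeakFreeTails k l → ListsWith isSplitCode
      from ((p , q) , (t , r)) = p ++ t , ∧-intro (isCode-++ 0 k l p t (∧-fst q) (∧-fst r))
        (∧-intro (subst (λ w → T (list== (codePeaks w) S1)) (sym (take-++ k p t (prefixLength p q))) (∧-snd {isCode 0 k p} q))
            (subst (λ w → T (peakFree false (ascents w))) (sym (drop-++ k p t (prefixLength p q))) (∧-snd {isCode k l t} r)))
      to∘from : ∀ y → to (from y) ≡ y
      to∘from ((p , q) , (t , r)) = cong₂ _,_ (witness-≡ (take-++ k p t (prefixLength p q))) (witness-≡ (drop-++ k p t (prefixLength p q)))
      from∘to : ∀ x → from (to x) ≡ x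
      from∘to (c , w) = witness-≡ (take++drop≡id k c)

    peaksAboveTop peaksUnchanged : List ℕ → Bool
    peaksAboveTop c = list== (codePeaks c) (S1 ++ suc k ∷ [])
    peaksUnchanged c = list== (codePeaks c) S1

    NewPeaks-above : ∀ J → NewPeaks k J → All (k ≤_) J
    NewPeaks-above .[] (inj₁ refl) = []
    NewPeaks-above .(k ∷ []) (inj₂ (inj₁ refl)) = ≤-refl ∷ []
    NewPeaks-above .(suc k ∷ []) (inj₂ (inj₂ refl)) = n≤1+n k ∷ []

    isSplitCode-intro : ∀ c J → T (isCode 0 n c) → codePeaks c ≡ S1 ++ J → NewPeaks k J → T (isSplitCode c)
    isSplitCode-intro c J code e zj = ∧-intro code (∧-intro (list==-complete (proj₁ unique)) (Decomposed.NewPeaks⇒peakFreeTail D (subst (NewPeaks k) (sym (proj₂ unique)) zj)))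
      where
      D = decompose c code
      J-above : All (k ≤_) J
      J-above = NewPeaks-above J zj
      unique = ++-split-unique k (codePeaks (take k c)) (Decomposed.Z D) S1 J (Decomposed.prefixPeaks-below D) S1<k (Decomposed.junctionPeaks-above D) J-above (trans (sym (Decomposed.peaks-cut D)) e)

    isSplitCode-elim : ∀ c → T (isSplitCode c) → Σ (List ℕ) λ Z → codePeaks c ≡ S1 ++ Z × NewPeaks k Z
    isSplitCode-elim c w = Decomposed.Z D , trans (Decomposed.peaks-cut D) (cong (_++ Decomposed.Z D) (list==-sound _ _ (∧-fst (∧-snd {isCode 0 n c} w)))) ,
                Decomposed.peakFreeTail⇒NewPeaks D (∧-snd {list== (codePeaks (take k c)) S1} (∧-snd {isCode 0 n c} w))
      where
      D = decompose c (∧-fst w)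

    ≢-snoc : ∀ (xs : List ℕ) x → xs ≢ xs ++ x ∷ []
    ≢-snoc [] x ()
    ≢-snoc (y ∷ xs) x e = ≢-snoc xs x (∷-injectiveʳ e)

    class-aboveTop : ListsWith (λ c → isSplitCode c ∧ peaksAboveTop c) ↔ Codes (S1 ++ suc k ∷ []) n
    class-aboveTop = ListsWith-≐ (λ c w → ∧-intro (∧-fst (∧-fst w)) (∧-snd {isSplitCode c} w))
                 (λ c q → ∧-intro (isSplitCode-intro c (suc k ∷ []) (∧-fst q) (list==-sound _ _ (∧-snd {isCode 0 n c} q)) (inj₂ (inj₂ refl))) (∧-snd {isCode 0 n c} q))

    class-noNewPeak : ListsWith (λ c → (isSplitCode c ∧ not (peaksAboveTop c)) ∧ peaksUnchanged c) ↔ Codes S1 n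
    class-noNewPeak = ListsWith-≐ (λ c w → ∧-intro (∧-fst (∧-fst (∧-fst w))) (∧-snd {isSplitCode c ∧ not (peaksAboveTop c)} w))
                 (λ c q → let e = list==-sound _ _ (∧-snd {isCode 0 n c} q) in
                    ∧-intro (∧-intro (isSplitCode-intro c [] (∧-fst q) (trans e (sym (++-identityʳ S1))) (inj₁ refl))
                           (¬T⇒T-not (λ t → ≢-snoc S1 (suc k) (trans (sym e) (list==-sound _ _ t)))))
                       (∧-snd {isCode 0 n c} q))

    class-atTop : ListsWith (λ c → (isSplitCode c ∧ not (peaksAboveTop c)) ∧ not (peaksUnchanged c)) ↔ Codes (S1 ++ k ∷ []) n
    class-atTop = ListsWith-≐ forth back
      where
      forth : ∀ c → T ((isSplitCode c ∧ not (peaksAboveTop c)) ∧ not (peaksUnchanged c)) → T (isCodeWith (S1 ++ k ∷ []) n c)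
      forth c w with isSplitCode-elim c (∧-fst (∧-fst w))
      ... | Z , e , inj₁ refl = ⊥-elim (T-not⇒¬T (∧-snd {isSplitCode c ∧ not (peaksAboveTop c)} w) (list==-complete (trans e (++-identityʳ S1))))
      ... | Z , e , inj₂ (inj₁ refl) = ∧-intro (∧-fst (∧-fst (∧-fst w))) (list==-complete e)
      ... | Z , e , inj₂ (inj₂ refl) = ⊥-elim (T-not⇒¬T (∧-snd {isSplitCode c} (∧-fst w)) (list==-complete e))
      back : ∀ c → T (isCodeWith (S1 ++ k ∷ []) n c) → T ((isSplitCode c ∧ not (peaksAboveTop c)) ∧ not (peaksUnchanged c))
      back c q = ∧-intro (∧-intro (isSplitCode-intro c (k ∷ []) (∧-fst q) e (inj₂ (inj₁ refl)))
                      (¬T⇒T-not (λ t → 1+n≢n (sym (∷-injectiveˡ (++-cancelˡ S1 (k ∷ []) (suc k ∷ []) (trans (sym e) (list==-sound _ _ t))))))))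
                  (¬T⇒T-not (λ t → ≢-snoc S1 k (sym (trans (sym e) (list==-sound _ _ t)))))
        where
        e = list==-sound _ _ (∧-snd {isCode 0 n c} q)

    peakRecurrence-↔ : (Codes (S1 ++ suc k ∷ []) n ⊎ (Codes S1 n ⊎ Codes (S1 ++ k ∷ []) n)) ↔ (Codes S1 k × PeakFreeTails k l)
    peakRecurrence-↔ = ↔-trans (↔-sym (class-aboveTop ⊎-↔ (class-noNewPeak ⊎-↔ class-atTop)))
      (↔-trans (↔-sym (↔-refl ⊎-↔ ListsWith-split (λ c → isSplitCode c ∧ not (peaksAboveTop c)) peaksUnchanged))
        (↔-trans (↔-sym (ListsWith-split isSplitCode peaksAboveTop)) splitCodes-↔-product))


module SeparatedSets where

  -- Peak positions are ≥ 2, pairwise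
  -- at distance ≥ 2, and below n; so a peak set S = S₁ ++ [x] forces
  -- x ≥ |S₁|·2 + 2 and every element of S₁ ≤ x − 2.  Sets that are not
  -- "separated" have no codes at all.

  open import Data.Nat using (ℕ; zero; suc; _+_; _*_; _<ᵇ_; _≤_; _<_; _⊔_; s≤s)
  open import Data.Nat.Properties
  open import Data.Nat.Solver using (module +-*-Solver)
  open import Data.Bool using (Bool; true; false; _∧_; T)
  open import Data.Fin using () renaming (zero to fzero)
  open import Data.List using (List; []; _∷_; _++_; length; foldr)
  open import Data.List.Relation.Unary.All using (All; []; _∷_)
  import Data.List.Relation.Unary.All as All
  open import Data.List.Relation.Unary.Any using (here)
  open import Data.List.Membership.Propositional.Properties using (∈-++⁺ʳ)
  open import Data.Product using (Σ; _×_; _,_)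
  open import Data.Empty using (⊥; ⊥-elim)
  open import Data.Unit using (tt)
  open import Relation.Binary.PropositionalEquality
  open import Function.Bundles using (mk↔ₛ′; Inverse)
  open Booleans
  open FiniteTypes
  open Codes

  -- Every element exceeds lo, and consecutive elements differ by ≥ 2.
  separatedFrom : ℕ → List ℕ → Bool
  separatedFrom lo [] = true
  separatedFrom lo (x ∷ xs) = (lo <ᵇ x) ∧ separatedFrom (suc x) xs

  maxL : List ℕ → ℕ
  maxL = foldr _⊔_ 0


  peaksAt-separated : ∀ lo pos up U → lo ≤ pos → (up ≡ true → lo < pos) → T (separatedFrom lo (peaksAt pos up U))
  peaksAt-separated lo pos up [] h1 h2 = tt
  peaksAt-separated lo pos true (false ∷ U) h1 h2 = ∧-intro (<⇒<ᵇ (h2 refl)) (peaksAt-separated (suc pos) (suc pos) false U ≤-refl (λ ()))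
  peaksAt-separated lo pos true (true ∷ U) h1 h2 = peaksAt-separated lo (suc pos) true U (m≤n⇒m≤1+n h1) (λ _ → s≤s h1)
  peaksAt-separated lo pos false (u ∷ U) h1 h2 = peaksAt-separated lo (suc pos) u U (m≤n⇒m≤1+n h1) (λ _ → s≤s h1)

  codePeaks-separated : ∀ c → T (separatedFrom 1 (codePeaks c))
  codePeaks-separated c = peaksAt-separated 1 1 false (ascents c) ≤-refl (λ ())

  codePeaks-bounded : ∀ c → All (_< length c) (codePeaks c)
  codePeaks-bounded [] = []
  codePeaks-bounded (y ∷ c) = subst (λ w → All (_< suc w) (codePeaks (y ∷ c))) (length-ascents y c) (peaksAt-upper 1 false (ascents (y ∷ c)))

  Codes-admissible : ∀ S n c → T (isCodeWith S n c) → T (separatedFrom 1 S) × All (_< n) S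
  Codes-admissible S n c q = subst (λ w → T (separatedFrom 1 w)) e (codePeaks-separated c) , subst₂ (λ w v → All (_< v) w) e (isCode-length 0 n c (∧-fst q)) (codePeaks-bounded c)
    where
    e : codePeaks c ≡ S
    e = list==-sound _ _ (∧-snd {isCode 0 n c} q)

  #Codes-empty : ∀ S n → (∀ c → T (isCodeWith S n c) → ⊥) → #Codes S n ≡ 0
  #Codes-empty S n h = sym (card-unique (finite-Codes S n) (mk↔ₛ′ (λ ()) (λ (c , q) → ⊥-elim (h c q)) (λ (c , q) → ⊥-elim (h c q)) (λ ())))

  #Codes-witness : ∀ S n → #Codes S n ≢ 0 → Σ (List ℕ) (λ c → T (isCodeWith S n c))
  #Codes-witness S n ne = element (finite-Codes S n) ne
    where
    element : ∀ {A : Set} (F : Finite A) → card F ≢ 0 → A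
    element (zero , e) ne = ⊥-elim (ne refl)
    element (suc N , e) ne = Inverse.to e fzero

  separated-above : ∀ lo xs → T (separatedFrom lo xs) → All (lo <_) xs
  separated-above lo [] p = []
  separated-above lo (x ∷ xs) p = <ᵇ∧-head lo x p ∷ All.map (λ q → <-trans (<ᵇ∧-head lo x p) (<-trans (n<1+n x) q)) (separated-above (suc x) xs (<ᵇ∧-tail lo x p))

  separated-snoc-gap : ∀ lo xs y → T (separatedFrom lo (xs ++ y ∷ [])) → All (λ x → suc x < y) xs
  separated-snoc-gap lo [] y p = []
  separated-snoc-gap lo (x ∷ xs) y p = All.lookup (separated-above (suc x) (xs ++ y ∷ []) (<ᵇ∧-tail lo x p)) (∈-++⁺ʳ xs (here refl)) ∷ separated-snoc-gap (suc x) xs y (<ᵇ∧-tail lo x p)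

  separated-snoc-length : ∀ lo xs y → T (separatedFrom lo (xs ++ y ∷ [])) → lo + 2 * length xs < y
  separated-snoc-length lo [] y p = subst (_< y) (sym (+-identityʳ lo)) (<ᵇ∧-head lo y p)
  separated-snoc-length lo (x ∷ xs) y p = ≤-<-trans le (separated-snoc-length (suc x) xs y (<ᵇ∧-tail lo x p))
    where
    open +-*-Solver
    regroup : ∀ a b → a + 2 * suc b ≡ suc (suc a) + 2 * b
    regroup = solve 2 (λ a b → a :+ con 2 :* (con 1 :+ b) := (con 1 :+ (con 1 :+ a)) :+ con 2 :* b) refl
    le : lo + 2 * suc (length xs) ≤ suc x + 2 * length xs
    le = ≤-trans (≤-reflexive (regroup lo (length xs))) (s≤s (+-monoˡ-≤ (2 * length xs) (<ᵇ∧-head lo x p)))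

  maxL-snoc : ∀ xs y → All (_≤ y) xs → maxL (xs ++ y ∷ []) ≡ y
  maxL-snoc [] y _ = ⊔-identityʳ y
  maxL-snoc (x ∷ xs) y (h ∷ hs) = trans (cong (x ⊔_) (maxL-snoc xs y hs)) (m≤n⇒m⊔n≡n h)

  maxL-< : ∀ xs n → 0 < n → All (_< n) xs → maxL xs < n
  maxL-< [] n p _ = p
  maxL-< (x ∷ xs) n p (h ∷ hs) = ⊔-lub h (maxL-< xs n p hs)


module IntegerPolynomials where

  -- The building blocks are the binomial polynomials
  -- binomPoly j, with binomPoly j (z) = C(z, j) for every integer z: they
  -- have degree j and integer values, and these two properties survive
  -- sums and integer multiples.

  open import Data.Nat as N using (ℕ; zero; suc; _≤_; _<_; s≤s; _∸_; _⊔_)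
  import Data.Nat.Properties as NP
  open import Data.Integer as ℤ using (ℤ; +_; -[1+_])
  import Data.Integer.Properties as ℤP
  import Data.Integer.Solver as ZS
  open import Data.Rational using (ℚ; _/_; _+_; _*_; -_; 0ℚ; 1ℚ; toℚᵘ; 1/_; ≢-nonZero)
  open import Data.Rational.Properties
    using (toℚᵘ-injective; toℚᵘ-homo-+; toℚᵘ-homo-*; toℚᵘ-homo‿-; toℚᵘ-fromℚᵘ; toℚᵘ-cong;
           *-inverseˡ; *-zeroʳ; 1≢0; *-zeroˡ; +-identityˡ; +-identityʳ; *-identityˡ)
  import Data.Rational.Unnormalised as U
  import Data.Rational.Unnormalised.Properties as UP
  import Data.Rational.Solver as QS
  open import Data.List using (List; []; _∷_; map; length; _++_; [_])
  open import Data.List.Properties using (length-map; map-++)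
  open import Data.Product using (_,_)
  open import Relation.Nullary using (yes; no)
  open import Relation.Binary.PropositionalEquality hiding ([_])
  open import Defs using (evalPoly; IntegerValued; HasDegree)
  open Binomials using (binom; binom-<; binom-absorption; binom-absorption-∸)

  ι : ℤ → ℚ
  ι z = z / 1

  ι-unnormalised : ∀ z → toℚᵘ (ι z) U.≃ U.mkℚᵘ z 0
  ι-unnormalised z = toℚᵘ-fromℚᵘ (U.mkℚᵘ z 0)

  private
    module IS = ZS.+-*-Solver

  ι-+ : ∀ a b → ι (a ℤ.+ b) ≡ ι a + ι b
  ι-+ a b = toℚᵘ-injective (UP.≃-trans (ι-unnormalised (a ℤ.+ b)) (UP.≃-trans e (UP.≃-sym (UP.≃-trans (toℚᵘ-homo-+ (ι a) (ι b)) (UP.+-cong (ι-unnormalised a) (ι-unnormalised b))))))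
    where
    e : U.mkℚᵘ (a ℤ.+ b) 0 U.≃ (U.mkℚᵘ a 0 U.+ U.mkℚᵘ b 0)
    e = U.*≡* (IS.solve 2 (λ a b → (a IS.:+ b) IS.:* (IS.con (+ 1) IS.:* IS.con (+ 1)) IS.:= (a IS.:* IS.con (+ 1) IS.:+ b IS.:* IS.con (+ 1)) IS.:* IS.con (+ 1)) refl a b)

  ι-* : ∀ a b → ι (a ℤ.* b) ≡ ι a * ι b
  ι-* a b = toℚᵘ-injective (UP.≃-trans (ι-unnormalised (a ℤ.* b)) (UP.≃-trans e (UP.≃-sym (UP.≃-trans (toℚᵘ-homo-* (ι a) (ι b)) (UP.*-cong (ι-unnormalised a) (ι-unnormalised b))))))
    where
    e : U.mkℚᵘ (a ℤ.* b) 0 U.≃ (U.mkℚᵘ a 0 U.* U.mkℚᵘ b 0)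
    e = U.*≡* (IS.solve 2 (λ a b → (a IS.:* b) IS.:* (IS.con (+ 1) IS.:* IS.con (+ 1)) IS.:= (a IS.:* b) IS.:* IS.con (+ 1)) refl a b)

  ι-neg : ∀ a → ι (ℤ.- a) ≡ - ι a
  ι-neg a = toℚᵘ-injective (UP.≃-trans (ι-unnormalised (ℤ.- a)) (UP.≃-sym (UP.≃-trans (toℚᵘ-homo‿- (ι a)) (UP.-‿cong (ι-unnormalised a)))))

  -- C(z, j) for an integer z: C(n, j) for z = n ≥ 0, and
  -- (−1)^j·C(k+j, j) for z = −(k+1); it obeys (j+1)·C(z, j+1) = C(z, j)·(z − j).
  alternating : ℕ → ℤ
  alternating zero = + 1
  alternating (suc j) = ℤ.- alternating j

  binomialℤ : ℤ → ℕ → ℤ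
  binomialℤ (+ n) j = + binom n j
  binomialℤ -[1+ k ] j = alternating j ℤ.* + binom (k N.+ j) j

  binomialℤ-step : ∀ z j → + suc j ℤ.* binomialℤ z (suc j) ≡ binomialℤ z j ℤ.* (z ℤ.- + j)
  binomialℤ-step (+ n) j with j N.≤? n
  ... | yes j≤n = begin
        + suc j ℤ.* + binom n (suc j)
      ≡⟨ sym (ℤP.pos-* (suc j) _) ⟩
        + (suc j N.* binom n (suc j))
      ≡⟨ cong +_ (trans (binom-absorption-∸ n j) (NP.*-comm (n ∸ j) _)) ⟩
        + (binom n j N.* (n ∸ j))
      ≡⟨ ℤP.pos-* (binom n j) _ ⟩
        + binom n j ℤ.* + (n ∸ j)
      ≡⟨ cong (λ w → + binom n j ℤ.* w) (sym dd) ⟩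
        + binom n j ℤ.* (+ n ℤ.- + j)
      ∎
    where
    open ≡-Reasoning
    dd : + n ℤ.- + j ≡ + (n ∸ j)
    dd = begin
        + n ℤ.- + j
      ≡⟨ cong (λ w → + w ℤ.- + j) (sym (NP.m+[n∸m]≡n j≤n)) ⟩
        + (j N.+ (n ∸ j)) ℤ.- + j
      ≡⟨ cong (ℤ._- + j) (ℤP.pos-+ j (n ∸ j)) ⟩
        (+ j ℤ.+ + (n ∸ j)) ℤ.- + j
      ≡⟨ IS.solve 2 (λ a b → (a IS.:+ b) IS.:- a IS.:= b) refl (+ j) (+ (n ∸ j)) ⟩
        + (n ∸ j)
      ∎
  ... | no j≰n = begin
        + suc j ℤ.* + binom n (suc j)
      ≡⟨ cong (λ w → + suc j ℤ.* + w) (binom-< (NP.m<n⇒m<1+n n<j)) ⟩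
        + suc j ℤ.* + 0
      ≡⟨ ℤP.*-zeroʳ (+ suc j) ⟩
        + 0
      ≡⟨ sym (ℤP.*-zeroˡ (+ n ℤ.- + j)) ⟩
        + 0 ℤ.* (+ n ℤ.- + j)
      ≡⟨ cong (λ w → + w ℤ.* (+ n ℤ.- + j)) (sym (binom-< n<j)) ⟩
        + binom n j ℤ.* (+ n ℤ.- + j)
      ∎
    where
    open ≡-Reasoning
    n<j : n < j
    n<j = NP.≰⇒> j≰n
  binomialℤ-step -[1+ k ] j = begin
        + suc j ℤ.* ((ℤ.- alternating j) ℤ.* + binom (k N.+ suc j) (suc j))
      ≡⟨ cong (λ w → + suc j ℤ.* ((ℤ.- alternating j) ℤ.* + binom w (suc j))) (NP.+-suc k j) ⟩
        + suc j ℤ.* ((ℤ.- alternating j) ℤ.* A)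
      ≡⟨ solve 3 (λ J s a → J :* ((:- s) :* a) := (:- s) :* (J :* a)) refl (+ suc j) (alternating j) A ⟩
        (ℤ.- alternating j) ℤ.* (+ suc j ℤ.* A)
      ≡⟨ cong ((ℤ.- alternating j) ℤ.*_) h ⟩
        (ℤ.- alternating j) ℤ.* (K ℤ.* Bv)
      ≡⟨ solve 3 (λ s Kv b → (:- s) :* (Kv :* b) := (s :* b) :* (:- Kv)) refl (alternating j) K Bv ⟩
        (alternating j ℤ.* Bv) ℤ.* (ℤ.- K)
      ≡⟨ cong (λ w → (alternating j ℤ.* Bv) ℤ.* w) (sym dd) ⟩
        (alternating j ℤ.* Bv) ℤ.* (-[1+ k ] ℤ.- + j)
      ∎
    where
    open ≡-Reasoning
    open ZS.+-*-Solver
    A = + binom (suc (k N.+ j)) (suc j)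
    Bv = + binom (k N.+ j) j
    K = + suc (k N.+ j)
    h : + suc j ℤ.* A ≡ K ℤ.* Bv
    h = trans (sym (ℤP.pos-* (suc j) _)) (trans (cong +_ (binom-absorption (k N.+ j) j)) (ℤP.pos-* (suc (k N.+ j)) _))
    dd : -[1+ k ] ℤ.- + j ≡ ℤ.- K
    dd = trans (sym (ℤP.neg-distrib-+ (+ suc k) (+ j))) (cong ℤ.-_ (sym (ℤP.pos-+ (suc k) j)))

  infixl 6 _⊕_
  _⊕_ : List ℚ → List ℚ → List ℚ
  [] ⊕ q = q
  (a ∷ p) ⊕ [] = a ∷ p
  (a ∷ p) ⊕ (b ∷ q) = (a + b) ∷ (p ⊕ q)

  scale : ℚ → List ℚ → List ℚ
  scale c = map (c *_)


  eval-⊕ : ∀ p q z → evalPoly (p ⊕ q) z ≡ evalPoly p z + evalPoly q z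
  eval-⊕ [] q z = sym (+-identityˡ _)
  eval-⊕ (a ∷ p) [] z = sym (+-identityʳ _)
  eval-⊕ (a ∷ p) (b ∷ q) z = trans (cong (λ w → (a + b) + ι z * w) (eval-⊕ p q z))
    (solve 5 (λ a b x P Q → (a :+ b) :+ x :* (P :+ Q) := (a :+ x :* P) :+ (b :+ x :* Q)) refl a b (ι z) (evalPoly p z) (evalPoly q z))
    where open QS.+-*-Solver

  eval-scale : ∀ c p z → evalPoly (scale c p) z ≡ c * evalPoly p z
  eval-scale c [] z = sym (*-zeroʳ c)
  eval-scale c (a ∷ p) z = trans (cong (λ w → c * a + ι z * w) (eval-scale c p z))
    (solve 4 (λ c a x P → c :* a :+ x :* (c :* P) := c :* (a :+ x :* P)) refl c a (ι z) (evalPoly p z))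
    where open QS.+-*-Solver

  recip : ℕ → ℚ
  recip j = + 1 / suc j

  recip-inverse : ∀ j → recip j * ι (+ suc j) ≡ 1ℚ
  recip-inverse j = toℚᵘ-injective (UP.≃-trans (toℚᵘ-homo-* (recip j) (ι (+ suc j)))
    (UP.≃-trans (UP.*-cong (toℚᵘ-fromℚᵘ (U.mkℚᵘ (+ 1) j)) (ι-unnormalised (+ suc j))) (U.*≡* e)))
    where
    e : (+ 1 ℤ.* + suc j) ℤ.* + 1 ≡ + 1 ℤ.* (+ suc j ℤ.* + 1)
    e = IS.solve 1 (λ x → (IS.con (+ 1) IS.:* x) IS.:* IS.con (+ 1) IS.:= IS.con (+ 1) IS.:* (x IS.:* IS.con (+ 1))) refl (+ suc j)

  binomPoly : ℕ → List ℚ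
  binomPoly zero = 1ℚ ∷ []
  binomPoly (suc j) = scale (recip j) ((0ℚ ∷ binomPoly j) ⊕ scale (- ι (+ j)) (binomPoly j))

  eval-binomPoly : ∀ j z → evalPoly (binomPoly j) z ≡ ι (binomialℤ z j)
  eval-binomPoly zero z = trans (cong (λ w → 1ℚ + w) (*-zeroʳ (ι z))) (trans (+-identityʳ 1ℚ) (cong ι (sym (b0 z))))
    where
    b0 : ∀ z → binomialℤ z 0 ≡ + 1
    b0 (+ n) = refl
    b0 -[1+ k ] = refl
  eval-binomPoly (suc j) z = begin
      evalPoly (binomPoly (suc j)) z
    ≡⟨ eval-scale (recip j) ((0ℚ ∷ binomPoly j) ⊕ scale (- ι (+ j)) (binomPoly j)) z ⟩
      recip j * evalPoly ((0ℚ ∷ binomPoly j) ⊕ scale (- ι (+ j)) (binomPoly j)) z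
    ≡⟨ cong (recip j *_) (eval-⊕ (0ℚ ∷ binomPoly j) (scale (- ι (+ j)) (binomPoly j)) z) ⟩
      recip j * ((0ℚ + ι z * evalPoly (binomPoly j) z) + evalPoly (scale (- ι (+ j)) (binomPoly j)) z)
    ≡⟨ cong (λ w → recip j * ((0ℚ + ι z * evalPoly (binomPoly j) z) + w)) (eval-scale (- ι (+ j)) (binomPoly j) z) ⟩
      recip j * ((0ℚ + ι z * evalPoly (binomPoly j) z) + (- ι (+ j)) * evalPoly (binomPoly j) z)
    ≡⟨ cong (λ w → recip j * ((0ℚ + ι z * w) + (- ι (+ j)) * w)) (eval-binomPoly j z) ⟩
      recip j * ((0ℚ + ι z * E) + (- ι (+ j)) * E)
    ≡⟨ solve 4 (λ r x y e → r :* ((con 0ℚ :+ x :* e) :+ (:- y) :* e) := r :* (e :* (x :+ (:- y)))) refl (recip j) (ι z) (ι (+ j)) E ⟩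
      recip j * (E * (ι z + - ι (+ j)))
    ≡⟨ cong (λ w → recip j * (E * (ι z + w))) (sym (ι-neg (+ j))) ⟩
      recip j * (E * (ι z + ι (ℤ.- + j)))
    ≡⟨ cong (λ w → recip j * (E * w)) (sym (ι-+ z (ℤ.- + j))) ⟩
      recip j * (E * ι (z ℤ.- + j))
    ≡⟨ cong (recip j *_) (sym (ι-* (binomialℤ z j) (z ℤ.- + j))) ⟩
      recip j * ι (binomialℤ z j ℤ.* (z ℤ.- + j))
    ≡⟨ cong (λ w → recip j * ι w) (sym (binomialℤ-step z j)) ⟩
      recip j * ι (+ suc j ℤ.* binomialℤ z (suc j))
    ≡⟨ cong (recip j *_) (ι-* (+ suc j) (binomialℤ z (suc j))) ⟩
      recip j * (ι (+ suc j) * ι (binomialℤ z (suc j)))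
    ≡⟨ solve 3 (λ r s b → r :* (s :* b) := (r :* s) :* b) refl (recip j) (ι (+ suc j)) (ι (binomialℤ z (suc j))) ⟩
      (recip j * ι (+ suc j)) * ι (binomialℤ z (suc j))
    ≡⟨ cong (_* ι (binomialℤ z (suc j))) (recip-inverse j) ⟩
      1ℚ * ι (binomialℤ z (suc j))
    ≡⟨ *-identityˡ _ ⟩
      ι (binomialℤ z (suc j))
    ∎
    where
    open ≡-Reasoning
    open QS.+-*-Solver
    E = ι (binomialℤ z j)


  intValued-⊕ : ∀ p q → IntegerValued p → IntegerValued q → IntegerValued (p ⊕ q)
  intValued-⊕ p q ip iq z with ip z | iq z
  ... | a , ea | b , eb = (a ℤ.+ b) , trans (eval-⊕ p q z) (trans (cong₂ _+_ ea eb) (sym (ι-+ a b)))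

  intValued-scale : ∀ c p → IntegerValued p → IntegerValued (scale (ι c) p)
  intValued-scale c p ip z with ip z
  ... | a , ea = (c ℤ.* a) , trans (eval-scale (ι c) p z) (trans (cong (ι c *_) ea) (sym (ι-* c a)))

  intValued-binomPoly : ∀ j → IntegerValued (binomPoly j)
  intValued-binomPoly j z = binomialℤ z j , eval-binomPoly j z

  intValued-one : IntegerValued (1ℚ ∷ [])
  intValued-one = intValued-binomPoly 0

  intValued-[] : IntegerValued []
  intValued-[] z = + 0 , refl


  length-⊕ : ∀ p q → length (p ⊕ q) ≡ length p ⊔ length q
  length-⊕ [] q = refl
  length-⊕ (a ∷ p) [] = refl
  length-⊕ (a ∷ p) (b ∷ q) = cong suc (length-⊕ p q)

  length-scale : ∀ c p → length (scale c p) ≡ length p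
  length-scale c p = length-map (c *_) p

  length-binomPoly : ∀ j → length (binomPoly j) ≡ suc j
  length-binomPoly zero = refl
  length-binomPoly (suc j) = trans (length-scale (recip j) ((0ℚ ∷ binomPoly j) ⊕ scale (- ι (+ j)) (binomPoly j))) (trans (length-⊕ (0ℚ ∷ binomPoly j) (scale (- ι (+ j)) (binomPoly j)))
    (trans (cong₂ (λ a b → suc a ⊔ b) (length-binomPoly j) (trans (length-scale (- ι (+ j)) (binomPoly j)) (length-binomPoly j))) (NP.m≥n⇒m⊔n≡m (NP.n≤1+n (suc j)))))


  *-nonzero : ∀ a b → a ≢ 0ℚ → b ≢ 0ℚ → a * b ≢ 0ℚ
  *-nonzero a b na nb e = nb (begin
      b
    ≡⟨ sym (*-identityˡ b) ⟩
      1ℚ * b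
    ≡⟨ cong (_* b) (sym (*-inverseˡ a {{≢-nonZero na}})) ⟩
      ((1/ a) {{≢-nonZero na}} * a) * b
    ≡⟨ solve 3 (λ u a b → (u :* a) :* b := u :* (a :* b)) refl ((1/ a) {{≢-nonZero na}}) a b ⟩
      (1/ a) {{≢-nonZero na}} * (a * b)
    ≡⟨ cong ((1/ a) {{≢-nonZero na}} *_) e ⟩
      (1/ a) {{≢-nonZero na}} * 0ℚ
    ≡⟨ *-zeroʳ ((1/ a) {{≢-nonZero na}}) ⟩
      0ℚ
    ∎)
    where
    open ≡-Reasoning
    open QS.+-*-Solver

  recip-nonzero : ∀ j → recip j ≢ 0ℚ
  recip-nonzero j e = 1≢0 (trans (sym (recip-inverse j)) (trans (cong (_* ι (+ suc j)) e) (*-zeroˡ (ι (+ suc j)))))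

  ι-injective : ∀ a b → ι a ≡ ι b → a ≡ b
  ι-injective a b e with UP.≃-trans (UP.≃-sym (ι-unnormalised a)) (UP.≃-trans (toℚᵘ-cong e) (ι-unnormalised b))
  ... | U.*≡* q = trans (sym (ℤP.*-identityʳ a)) (trans q (ℤP.*-identityʳ b))


  ⊕-snoc : ∀ (ini : List ℚ) c q → length q N.≤ length ini → (ini ++ [ c ]) ⊕ q ≡ (ini ⊕ q) ++ [ c ]
  ⊕-snoc [] c [] _ = refl
  ⊕-snoc (a ∷ ini) c [] _ = refl
  ⊕-snoc (a ∷ ini) c (b ∷ q) (s≤s h) = cong ((a + b) ∷_) (⊕-snoc ini c q h)

  length-⊕-shorter : ∀ (ini q : List ℚ) → length q N.≤ length ini → length (ini ⊕ q) ≡ length ini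
  length-⊕-shorter ini q h = trans (length-⊕ ini q) (NP.m≥n⇒m⊔n≡m h)

  degree-⊕ : ∀ p q d → HasDegree p d → length q N.≤ d → HasDegree (p ⊕ q) d
  degree-⊕ p q d (ini , c , refl , li , nz) h = (ini ⊕ q) , c , ⊕-snoc ini c q (subst (length q N.≤_) (sym li) h) ,
    trans (length-⊕-shorter ini q (subst (length q N.≤_) (sym li) h)) li , nz

  degree-scale : ∀ a p d → a ≢ 0ℚ → HasDegree p d → HasDegree (scale a p) d
  degree-scale a p d na (ini , c , refl , li , nz) = scale a ini , a * c , map-++ (a *_) ini [ c ] ,
    trans (length-scale a ini) li , *-nonzero a c na nz

  degree-binomPoly : ∀ j → HasDegree (binomPoly j) j
  degree-binomPoly zero = [] , 1ℚ , refl , refl , λ ()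
  degree-binomPoly (suc j) with degree-binomPoly j
  ... | ini , c , e , li , nz = degree-scale (recip j) ((0ℚ ∷ binomPoly j) ⊕ scale (- ι (+ j)) (binomPoly j)) (suc j) (recip-nonzero j)
    (degree-⊕ (0ℚ ∷ binomPoly j) (scale (- ι (+ j)) (binomPoly j)) (suc j) (0ℚ ∷ ini , c , cong (0ℚ ∷_) e , cong suc li , nz)
       (NP.≤-reflexive (trans (length-scale (- ι (+ j)) (binomPoly j)) (length-binomPoly j))))


module PeakPolynomials where

  -- S = [] is #Codes-[]; a non-separated S has no
  -- codes (p_S = 0); otherwise S = S₁ ++ [k+1] with S₁ < k, and the peak
  -- recurrence with S₂ = S₁ ++ [k] gives, for n = k + l (l ≥ 1),
  --   #Codes S n = #Codes S₁ k · C(n, k) · 2^(l−1) − #Codes S₁ n − #Codes S₂ n,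
  -- i.e. p_S = c·C(z, k) − 2·p_{S₁} − p_{S₂} with c = p_{S₁}(k) ∈ ℤ.  When S
  -- has a code, c ≠ 0 and p_S has degree exactly k = max S − 1.

  open import Data.Nat using (ℕ; zero; suc; _+_; _*_; _∸_; _^_; _≤_; _<_; _⊔_; s≤s; z≤n)
  open import Data.Nat.Properties
  open import Data.Bool using (true; false; T)
  open import Data.List using (List; []; _∷_; _++_; length)
  open import Data.List.Properties using (length-++)
  open import Data.List.Relation.Unary.All using (All)
  import Data.List.Relation.Unary.All as All
  open import Data.List.Relation.Unary.All.Properties using (++⁻ʳ)
  open import Data.Product using (Σ; _,_; proj₁; proj₂)
  open import Data.Empty using (⊥; ⊥-elim)
  open import Data.Unit using (tt)
  open import Data.Integer as ℤ using (ℤ; +_; -[1+_])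
  import Data.Integer.Properties as ℤP
  open import Data.Rational using (ℚ; 0ℚ; 1ℚ) renaming (_+_ to _⊹_; _*_ to _⊛_; -_ to ⊝_)
  import Data.Rational.Properties as QP
  import Data.Rational.Solver as QS
  open import Relation.Binary.PropositionalEquality
  open import Defs using (evalPoly; IntegerValued; HasDegree)
  open Booleans
  open FiniteTypes
  open Codes
  open Binomials
  open PeakFreeTailCount
  open PeakRecurrence
  open SeparatedSets
  open IntegerPolynomials

  ι-ℕ+ : ∀ a b → ι (+ (a + b)) ≡ ι (+ a) ⊹ ι (+ b)
  ι-ℕ+ a b = trans (cong ι (ℤP.pos-+ a b)) (ι-+ (+ a) (+ b))

  ι-ℕ* : ∀ a b → ι (+ (a * b)) ≡ ι (+ a) ⊛ ι (+ b)
  ι-ℕ* a b = trans (cong ι (ℤP.pos-* a b)) (ι-* (+ a) (+ b))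

  ι-2^-+ : ∀ x y → ι (+ (2 ^ (x + y))) ≡ ι (+ (2 ^ x)) ⊛ ι (+ (2 ^ y))
  ι-2^-+ x y = trans (cong (λ w → ι (+ w)) (^-distribˡ-+-* 2 x y)) (ι-ℕ* (2 ^ x) (2 ^ y))

  record PeakPolynomial (S : List ℕ) : Set where
    field
      poly : List ℚ
      short : length poly ≤ maxL S ⊔ 1
      intValued : IntegerValued poly
      counts : ∀ n → 1 ≤ n → maxL S < n →
        ι (+ #Codes S n) ≡ evalPoly poly (+ n) ⊛ ι (+ (2 ^ (n ∸ length S ∸ 1)))

  peakPolynomial-[] : PeakPolynomial []
  peakPolynomial-[] = record { poly = 1ℚ ∷ [] ; short = ≤-refl ; intValued = intValued-one ; counts = counts }
    where
    counts : ∀ n → 1 ≤ n → maxL [] < n → ι (+ #Codes [] n) ≡ evalPoly (1ℚ ∷ []) (+ n) ⊛ ι (+ (2 ^ (n ∸ 0 ∸ 1)))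
    counts (suc l) _ _ = trans (cong (λ w → ι (+ w)) (#Codes-[] l))
      (sym (trans (cong (_⊛ ι (+ (2 ^ l))) (trans (cong (1ℚ ⊹_) (QP.*-zeroʳ (ι (+ suc l)))) (QP.+-identityʳ 1ℚ))) (QP.*-identityˡ _)))

  peakPolynomial-nonSeparated : ∀ S → (T (separatedFrom 1 S) → ⊥) → PeakPolynomial S
  peakPolynomial-nonSeparated S ns = record { poly = [] ; short = z≤n ; intValued = intValued-[] ; counts = counts }
    where
    counts : ∀ n → 1 ≤ n → maxL S < n → ι (+ #Codes S n) ≡ evalPoly [] (+ n) ⊛ ι (+ (2 ^ (n ∸ length S ∸ 1)))
    counts n _ _ = trans (cong (λ w → ι (+ w)) (#Codes-empty S n (λ c q → ns (proj₁ (Codes-admissible S n c q)))))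
      (sym (QP.*-zeroˡ (ι (+ (2 ^ (n ∸ length S ∸ 1))))))

  separated-last≥2 : ∀ S1 x → T (separatedFrom 1 (S1 ++ x ∷ [])) → Σ ℕ λ k0 → x ≡ suc (suc k0)
  separated-last≥2 S1 zero p with separated-snoc-length 1 S1 zero p
  ... | ()
  separated-last≥2 S1 (suc zero) p = ⊥-elim (<⇒≱ (separated-snoc-length 1 S1 1 p) (s≤s z≤n))
  separated-last≥2 S1 (suc (suc k0)) p = k0 , refl

  <⇒+suc : ∀ k n → suc k < n → Σ ℕ λ l0 → k + suc l0 ≡ n
  <⇒+suc k n h = proj₁ e , trans (+-suc k (proj₁ e)) (proj₂ e)
    where e = m≤n⇒∃[o]m+o≡n (<⇒≤ h)

  module InductionStep (S1 : List ℕ) (k0 : ℕ) (sepS : T (separatedFrom 1 (S1 ++ suc (suc k0) ∷ []))) where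
    k = suc k0
    m = suc k
    S = S1 ++ m ∷ []
    S2 = S1 ++ k ∷ []
    a = length S1

    S1<k : All (_< k) S1
    S1<k = All.map (λ q → ≤-pred q) (separated-snoc-gap 1 S1 m sepS)

    a<k : a < k
    a<k = ≤-pred (≤-trans (s≤s (s≤s (≤-trans (m≤n+m a a) (≤-reflexive (cong (λ w → a + w) (sym (+-identityʳ a))))))) (separated-snoc-length 1 S1 m sepS))

    lenS : length S ≡ suc a
    lenS = trans (length-++ S1) (+-comm a 1)

    lenS2 : length S2 ≡ suc a
    lenS2 = trans (length-++ S1) (+-comm a 1)

    maxS : maxL S ≡ m
    maxS = maxL-snoc S1 m (All.map (λ q → ≤-trans (<⇒≤ q) (n≤1+n k)) S1<k)

    maxS2 : maxL S2 ≡ k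
    maxS2 = maxL-snoc S1 k (All.map <⇒≤ S1<k)

    maxS1 : maxL S1 < k
    maxS1 = maxL-< S1 k (s≤s z≤n) S1<k

    peakRecurrence : ∀ l0 → #Codes S (k + suc l0) + (#Codes S1 (k + suc l0) + #Codes S2 (k + suc l0))
                          ≡ #Codes S1 k * (binom (k + suc l0) k * 2 ^ l0)
    peakRecurrence l0 =
      trans (card-↔ (finite⊎ (finite-Codes S n) (finite⊎ (finite-Codes S1 n) (finite-Codes S2 n)))
                    (finite× (finite-Codes S1 k) (finite-PeakFreeTails k (suc l0))) peakRecurrence-↔)
            (cong (#Codes S1 k *_) (sym (card-unique (finite-PeakFreeTails k (suc l0)) (PeakFreeTails-count l0 k))))
      where
      open Decomposition S1 k0 l0 S1<k using (peakRecurrence-↔; n)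

    module FromHypotheses (ih₁ : PeakPolynomial S1) (ih₂ : PeakPolynomial S2) where
      open PeakPolynomial ih₁ renaming (poly to p1; short to short1; intValued to iv1; counts to counts1)
      open PeakPolynomial ih₂ renaming (poly to p2; short to short2; intValued to iv2; counts to counts2)

      c : ℤ
      c = proj₁ (iv1 (+ k))
      ec : evalPoly p1 (+ k) ≡ ι c
      ec = proj₂ (iv1 (+ k))

      rest : List ℚ
      rest = scale (ι -[1+ 1 ]) p1 ⊕ scale (ι -[1+ 0 ]) p2

      P : List ℚ
      P = scale (ι c) (binomPoly k) ⊕ rest

      gap : ℕ
      gap = proj₁ (m≤n⇒∃[o]m+o≡n a<k)
      k≡ : suc a + gap ≡ k
      k≡ = proj₂ (m≤n⇒∃[o]m+o≡n a<k)

      drop-a+1 : ∀ a X → (suc a + X) ∸ a ∸ 1 ≡ X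
      drop-a+1 zero X = refl
      drop-a+1 (suc a) X = drop-a+1 a X

      drop-a+2 : ∀ a Y → (suc a + suc Y) ∸ suc a ∸ 1 ≡ Y
      drop-a+2 zero Y = refl
      drop-a+2 (suc a) Y = drop-a+2 a Y

      exp-k : k ∸ a ∸ 1 ≡ gap
      exp-k = trans (cong (λ w → w ∸ a ∸ 1) (sym k≡)) (drop-a+1 a gap)

      n≡ : ∀ l0 → k + suc l0 ≡ suc a + suc (gap + l0)
      n≡ l0 = trans (cong (_+ suc l0) (sym k≡)) (trans (+-assoc (suc a) gap (suc l0)) (cong (λ w → suc a + w) (+-suc gap l0)))

      exp-S₁ : ∀ l0 → (k + suc l0) ∸ a ∸ 1 ≡ suc (gap + l0)
      exp-S₁ l0 = trans (cong (λ w → w ∸ a ∸ 1) (n≡ l0)) (drop-a+1 a (suc (gap + l0)))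

      exp-S : ∀ l0 → (k + suc l0) ∸ suc a ∸ 1 ≡ gap + l0
      exp-S l0 = trans (cong (λ w → w ∸ suc a ∸ 1) (n≡ l0)) (drop-a+2 a (gap + l0))

      rest-short : length rest ≤ k
      rest-short = subst (_≤ k) (sym (trans (length-⊕ (scale (ι -[1+ 1 ]) p1) (scale (ι -[1+ 0 ]) p2))
                                            (cong₂ _⊔_ (length-scale (ι -[1+ 1 ]) p1) (length-scale (ι -[1+ 0 ]) p2))))
        (⊔-lub (≤-trans short1 (⊔-lub (<⇒≤ maxS1) (s≤s z≤n)))
               (≤-trans short2 (≤-reflexive (trans (cong (_⊔ 1) maxS2) (m≥n⇒m⊔n≡m (s≤s z≤n))))))

      lenP : length P ≡ m
      lenP = trans (length-⊕ (scale (ι c) (binomPoly k)) rest)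
        (trans (cong (_⊔ length rest) (trans (length-scale (ι c) (binomPoly k)) (length-binomPoly k)))
               (m≥n⇒m⊔n≡m (≤-trans rest-short (n≤1+n k))))

      ivP : IntegerValued P
      ivP = intValued-⊕ (scale (ι c) (binomPoly k)) rest (intValued-scale c (binomPoly k) (intValued-binomPoly k))
              (intValued-⊕ (scale (ι -[1+ 1 ]) p1) (scale (ι -[1+ 0 ]) p2) (intValued-scale -[1+ 1 ] p1 iv1) (intValued-scale -[1+ 0 ] p2 iv2))

      degP : ι c ≢ 0ℚ → HasDegree P k
      degP nz = degree-⊕ (scale (ι c) (binomPoly k)) rest k (degree-scale (ι c) (binomPoly k) k nz (degree-binomPoly k)) rest-short

      eval-P : ∀ n → evalPoly P (+ n) ≡ ι c ⊛ ι (+ binom n k) ⊹ (ι -[1+ 1 ] ⊛ evalPoly p1 (+ n) ⊹ ι -[1+ 0 ] ⊛ evalPoly p2 (+ n))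
      eval-P n = trans (eval-⊕ (scale (ι c) (binomPoly k)) rest (+ n))
        (cong₂ _⊹_ (trans (eval-scale (ι c) (binomPoly k) (+ n)) (cong (ι c ⊛_) (eval-binomPoly k (+ n))))
                   (trans (eval-⊕ (scale (ι -[1+ 1 ]) p1) (scale (ι -[1+ 0 ]) p2) (+ n))
                          (cong₂ _⊹_ (eval-scale (ι -[1+ 1 ]) p1 (+ n)) (eval-scale (ι -[1+ 0 ]) p2 (+ n)))))

      peakFormula : ∀ l0 → ι (+ #Codes S (k + suc l0)) ≡ evalPoly P (+ (k + suc l0)) ⊛ ι (+ (2 ^ ((k + suc l0) ∸ length S ∸ 1)))
      peakFormula l0 = begin
          X
        ≡⟨ solve 3 (λ x y1 y2 → x := (x :+ (y1 :+ y2)) :+ (:- (y1 :+ y2))) refl X Y1 Y2 ⟩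
          (X ⊹ (Y1 ⊹ Y2)) ⊹ ⊝ (Y1 ⊹ Y2)
        ≡⟨ cong (λ w → w ⊹ ⊝ (Y1 ⊹ Y2)) recurrence ⟩
          F ⊛ (Bn ⊛ T0) ⊹ ⊝ (Y1 ⊹ Y2)
        ≡⟨ cong₂ (λ u v → u ⊛ (Bn ⊛ T0) ⊹ ⊝ v) count-S₁-at-k (cong₂ _⊹_ count-S₁ count-S₂) ⟩
          (C ⊛ T') ⊛ (Bn ⊛ T0) ⊹ ⊝ (P1n ⊛ (ι (+ 2) ⊛ (T' ⊛ T0)) ⊹ P2n ⊛ (T' ⊛ T0))
        ≡⟨ solve 6 (λ c t b t0 q1 q2 → (c :* t) :* (b :* t0) :+ (:- (q1 :* (con (ι (+ 2)) :* (t :* t0)) :+ q2 :* (t :* t0)))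
                     := (c :* b :+ (con (ι -[1+ 1 ]) :* q1 :+ con (ι -[1+ 0 ]) :* q2)) :* (t :* t0)) refl C T' Bn T0 P1n P2n ⟩
          (C ⊛ Bn ⊹ (ι -[1+ 1 ] ⊛ P1n ⊹ ι -[1+ 0 ] ⊛ P2n)) ⊛ (T' ⊛ T0)
        ≡⟨ cong₂ _⊛_ (sym (eval-P n)) (sym power) ⟩
          evalPoly P (+ n) ⊛ ι (+ (2 ^ (n ∸ length S ∸ 1)))
        ∎
        where
        open ≡-Reasoning
        open QS.+-*-Solver
        n = k + suc l0
        k<n : k < n
        k<n = subst (_≤ n) (+-comm k 1) (+-monoʳ-≤ k (s≤s z≤n))
        X = ι (+ #Codes S n)
        Y1 = ι (+ #Codes S1 n)
        Y2 = ι (+ #Codes S2 n)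
        F = ι (+ #Codes S1 k)
        T' = ι (+ (2 ^ gap))
        T0 = ι (+ (2 ^ l0))
        Bn = ι (+ binom n k)
        P1n = evalPoly p1 (+ n)
        P2n = evalPoly p2 (+ n)
        C = ι c
        recurrence : X ⊹ (Y1 ⊹ Y2) ≡ F ⊛ (Bn ⊛ T0)
        recurrence = trans (sym (trans (ι-ℕ+ (#Codes S n) _) (cong (X ⊹_) (ι-ℕ+ (#Codes S1 n) _))))
          (trans (cong (λ w → ι (+ w)) (peakRecurrence l0)) (trans (ι-ℕ* (#Codes S1 k) _) (cong (F ⊛_) (ι-ℕ* (binom n k) _))))
        count-S₁ : Y1 ≡ P1n ⊛ (ι (+ 2) ⊛ (T' ⊛ T0))
        count-S₁ = trans (counts1 n (s≤s z≤n) (<-trans maxS1 k<n))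
          (cong (P1n ⊛_) (trans (cong (λ w → ι (+ (2 ^ w))) (exp-S₁ l0)) (trans (ι-ℕ* 2 (2 ^ (gap + l0))) (cong (ι (+ 2) ⊛_) (ι-2^-+ gap l0)))))
        count-S₂ : Y2 ≡ P2n ⊛ (T' ⊛ T0)
        count-S₂ = trans (counts2 n (s≤s z≤n) (subst (_< n) (sym maxS2) k<n))
          (cong (P2n ⊛_) (trans (cong (λ w → ι (+ (2 ^ (n ∸ w ∸ 1)))) lenS2) (trans (cong (λ w → ι (+ (2 ^ w))) (exp-S l0)) (ι-2^-+ gap l0))))
        count-S₁-at-k : F ≡ C ⊛ T'
        count-S₁-at-k = trans (counts1 k (s≤s z≤n) maxS1) (cong₂ _⊛_ ec (cong (λ w → ι (+ (2 ^ w))) exp-k))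
        power : ι (+ (2 ^ (n ∸ length S ∸ 1))) ≡ T' ⊛ T0
        power = trans (cong (λ w → ι (+ (2 ^ (n ∸ w ∸ 1)))) lenS) (trans (cong (λ w → ι (+ (2 ^ w))) (exp-S l0)) (ι-2^-+ gap l0))

      -- If S has a code at all, then c ≠ 0: otherwise #Codes S₁ k = 0, and
      -- the recurrence forces #Codes S n = 0 for every n.
      c≢0 : ∀ n → #Codes S n ≢ 0 → ι c ≢ 0ℚ
      c≢0 n ne c≡0 = ne (trans (cong (#Codes S) (sym n≡k+o+1)) no-codes)
        where
        code = #Codes-witness S n ne
        m<n : m < n
        m<n = All.head (++⁻ʳ S1 (proj₂ (Codes-admissible S n (proj₁ code) (proj₂ code))))
        o = proj₁ (m≤n⇒∃[o]m+o≡n (<⇒≤ m<n))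
        n≡k+o+1 : k + suc o ≡ n
        n≡k+o+1 = trans (+-suc k o) (proj₂ (m≤n⇒∃[o]m+o≡n (<⇒≤ m<n)))
        none-at-k : #Codes S1 k ≡ 0
        none-at-k = ℤP.+-injective (ι-injective (+ #Codes S1 k) (+ 0)
          (trans (counts1 k (s≤s z≤n) maxS1) (trans (cong (_⊛ ι (+ (2 ^ (k ∸ a ∸ 1)))) (trans ec c≡0)) (QP.*-zeroˡ (ι (+ (2 ^ (k ∸ a ∸ 1))))))))
        no-codes : #Codes S (k + suc o) ≡ 0
        no-codes = m+n≡0⇒m≡0 (#Codes S (k + suc o)) (trans (peakRecurrence o) (cong (_* (binom (k + suc o) k * 2 ^ o)) none-at-k))

  peakPolynomial-snoc : ∀ S1 k0 (sepS : T (separatedFrom 1 (S1 ++ suc (suc k0) ∷ []))) →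
    PeakPolynomial S1 → PeakPolynomial (S1 ++ suc k0 ∷ []) → PeakPolynomial (S1 ++ suc (suc k0) ∷ [])
  peakPolynomial-snoc S1 k0 sepS ih₁ ih₂ = record
    { poly = P ; short = ≤-trans (≤-reflexive (trans lenP (sym maxS))) (m≤m⊔n _ 1) ; intValued = ivP ; counts = counts }
    where
    open InductionStep S1 k0 sepS
    open FromHypotheses ih₁ ih₂
    counts : ∀ n → 1 ≤ n → maxL S < n → ι (+ #Codes S n) ≡ evalPoly P (+ n) ⊛ ι (+ (2 ^ (n ∸ length S ∸ 1)))
    counts n _ h with <⇒+suc k n (subst (_< n) maxS h)
    ... | l0 , refl = peakFormula l0

  peakPolynomial-all : ∀ B S → maxL S < B → PeakPolynomial S
  peakPolynomial-all zero S ()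
  peakPolynomial-all (suc B) [] h = peakPolynomial-[]
  peakPolynomial-all (suc B) (y ∷ t) h =
    subst PeakPolynomial (initLast y t) (bySnoc (initL (y ∷ t)) (lastL (y ∷ t)) (subst (λ w → maxL w < suc B) (sym (initLast y t)) h))
    where
    bySnoc : ∀ S1 x → maxL (S1 ++ x ∷ []) < suc B → PeakPolynomial (S1 ++ x ∷ [])
    bySnoc S1 x hb with separatedFrom 1 (S1 ++ x ∷ []) in es
    ... | false = peakPolynomial-nonSeparated (S1 ++ x ∷ []) (λ q → subst T es q)
    ... | true with separated-last≥2 S1 x (subst T (sym es) tt)
    ...   | k0 , refl = peakPolynomial-snoc S1 k0 sepS (peakPolynomial-all B S1 (<-≤-trans maxS1 k≤B))
                          (peakPolynomial-all B S2 (subst (_< B) (sym maxS2) (<-≤-trans (n<1+n k) (≤-pred m<B+1))))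
      where
      sepS = subst T (sym es) tt
      open InductionStep S1 k0 sepS
      m<B+1 : m < suc B
      m<B+1 = subst (_< suc B) maxS hb
      k≤B : k ≤ B
      k≤B = <⇒≤ (≤-pred m<B+1)


module PunchInOut where

  -- Both are strictly monotone where defined, so they
  -- preserve every comparison; this is what makes the Lehmer code below
  -- preserve ascents.

  open import Data.Nat using (ℕ; zero; suc; pred; _<ᵇ_; _≤_; _<_; z≤n; s≤s)
  open import Data.Nat.Properties
  open import Data.Bool using (if_then_else_)
  open import Data.Sum using (inj₁; inj₂)
  open import Relation.Nullary using (yes; no)
  open import Data.Empty using (⊥-elim)
  open import Relation.Binary.PropositionalEquality
  open Booleans

  punchInℕ : ℕ → ℕ → ℕ
  punchInℕ x y = if y <ᵇ x then y else suc y

  punchOutℕ : ℕ → ℕ → ℕ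
  punchOutℕ x y = if y <ᵇ x then y else pred y

  punchIn-below : ∀ {x y} → y < x → punchInℕ x y ≡ y
  punchIn-below {x} {y} h rewrite <⇒<ᵇ≡true h = refl

  punchIn-above : ∀ {x y} → x ≤ y → punchInℕ x y ≡ suc y
  punchIn-above {x} {y} h rewrite ≥⇒<ᵇ≡false {y} {x} h = refl

  punchOut-below : ∀ {x y} → y < x → punchOutℕ x y ≡ y
  punchOut-below {x} {y} h rewrite <⇒<ᵇ≡true h = refl

  punchOut-above : ∀ {x y} → x ≤ y → punchOutℕ x y ≡ pred y
  punchOut-above {x} {y} h rewrite ≥⇒<ᵇ≡false {y} {x} h = refl

  punchOut-punchIn : ∀ x y → punchOutℕ x (punchInℕ x y) ≡ y
  punchOut-punchIn x y with <-or-≥ y x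
  ... | inj₁ h = trans (cong (punchOutℕ x) (punchIn-below h)) (punchOut-below h)
  ... | inj₂ h = trans (cong (punchOutℕ x) (punchIn-above h)) (punchOut-above (m≤n⇒m≤1+n h))

  punchIn-punchOut : ∀ x y → y ≢ x → punchInℕ x (punchOutℕ x y) ≡ y
  punchIn-punchOut x y ne with <-or-≥ y x
  ... | inj₁ h = trans (cong (punchInℕ x) (punchOut-below h)) (punchIn-below h)
  punchIn-punchOut x zero ne | inj₂ h = ⊥-elim (ne (sym (n≤0⇒n≡0 h)))
  punchIn-punchOut x (suc y) ne | inj₂ h = trans (cong (punchInℕ x) (punchOut-above h)) (punchIn-above (≤-pred (≤∧≢⇒< h (λ e → ne (sym e)))))

  punchIn-≢ : ∀ x y → punchInℕ x y ≢ x
  punchIn-≢ x y with <-or-≥ y x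
  ... | inj₁ h = λ e → <-irrefl (trans (sym (punchIn-below h)) e) h
  ... | inj₂ h = λ e → <-irrefl (sym e) (subst (x <_) (sym (punchIn-above h)) (s≤s h))

  punchOut-≤ : ∀ x {a b} → a ≤ b → punchOutℕ x a ≤ punchOutℕ x b
  punchOut-≤ x {a} {b} h with <-or-≥ a x | <-or-≥ b x
  ... | inj₁ ha | inj₁ hb = subst₂ _≤_ (sym (punchOut-below ha)) (sym (punchOut-below hb)) h
  ... | inj₁ ha | inj₂ hb = subst₂ _≤_ (sym (punchOut-below ha)) (sym (punchOut-above hb)) (pred-bound ha hb)
    where
    pred-bound : ∀ {a x b} → a < x → x ≤ b → a ≤ pred b
    pred-bound {a} {x} {suc b} p q = ≤-pred (≤-trans p q)
    pred-bound {a} {x} {zero} p q = ⊥-elim (<⇒≱ p (≤-trans q z≤n))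
  ... | inj₂ ha | inj₁ hb = ⊥-elim (<⇒≱ hb (≤-trans ha h))
  ... | inj₂ ha | inj₂ hb = subst₂ _≤_ (sym (punchOut-above ha)) (sym (punchOut-above hb)) (pred-mono-≤ h)

  punchOut-< : ∀ x {a b} → a ≢ x → b ≢ x → a < b → punchOutℕ x a < punchOutℕ x b
  punchOut-< x {a} {b} na nb h with <-or-≥ a x | <-or-≥ b x
  ... | inj₁ ha | inj₁ hb = subst₂ _<_ (sym (punchOut-below ha)) (sym (punchOut-below hb)) h
  ... | inj₁ ha | inj₂ hb = subst₂ _<_ (sym (punchOut-below ha)) (sym (punchOut-above hb)) (pred-bound ha (≤∧≢⇒< hb (λ e → nb (sym e))))
    where
    pred-bound : ∀ {a x b} → a < x → x < b → a < pred b
    pred-bound {a} {x} {suc b} p q = <-≤-trans p (≤-pred q)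
  ... | inj₂ ha | inj₁ hb = ⊥-elim (<⇒≱ hb (≤-trans ha (<⇒≤ h)))
  ... | inj₂ ha | inj₂ hb = subst₂ _<_ (sym (punchOut-above ha)) (sym (punchOut-above hb)) (pred-bound (≤∧≢⇒< ha (λ e → na (sym e))) h)
    where
    pred-bound : ∀ {x a b} → x < a → a < b → pred a < pred b
    pred-bound {x} {suc a} {suc b} p q = ≤-pred q

  <ᵇ-punchOut : ∀ x a b → a ≢ x → b ≢ x → (punchOutℕ x a <ᵇ punchOutℕ x b) ≡ (a <ᵇ b)
  <ᵇ-punchOut x a b na nb = <ᵇ-cong-⇔ back (punchOut-< x na nb)
    where
    back : punchOutℕ x a < punchOutℕ x b → a < b
    back q with a <? b
    ... | yes p = p
    ... | no p = ⊥-elim (<⇒≱ q (punchOut-≤ x (≮⇒≥ p)))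

  <ᵇ-punchOut-pivot : ∀ x y → y ≢ x → (punchOutℕ x y <ᵇ x) ≡ (y <ᵇ x)
  <ᵇ-punchOut-pivot x y ny with <-or-≥ y x
  ... | inj₁ h = cong (_<ᵇ x) (punchOut-below h)
  ... | inj₂ h = trans (≥⇒<ᵇ≡false (subst (x ≤_) (sym (punchOut-above h)) (pred-bound (≤∧≢⇒< h (λ e → ny (sym e)))))) (sym (≥⇒<ᵇ≡false h))
    where
    pred-bound : ∀ {x y} → x < y → x ≤ pred y
    pred-bound {x} {suc y} p = ≤-pred p

  punchIn-bound : ∀ {n x y} → y < n → x ≤ n → punchInℕ x y < suc n
  punchIn-bound {n} {x} {y} h hx with <-or-≥ y x
  ... | inj₁ p = subst (_< suc n) (sym (punchIn-below p)) (m<n⇒m<1+n h)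
  ... | inj₂ p = subst (_< suc n) (sym (punchIn-above p)) (s≤s h)

  punchOut-bound : ∀ {n x y} → y < suc n → y ≢ x → x < suc n → punchOutℕ x y < n
  punchOut-bound {n} {x} {y} h ny hx with <-or-≥ y x
  ... | inj₁ p = subst (_< n) (sym (punchOut-below p)) (<-≤-trans p (≤-pred hx))
  ... | inj₂ p = subst (_< n) (sym (punchOut-above p)) (pred-bound (≤∧≢⇒< p (λ e → ny (sym e))) h)
    where
    pred-bound : ∀ {x y n} → x < y → y < suc n → pred y < n
    pred-bound {x} {suc y} p q = ≤-pred q


module LehmerCode where

  -- Its Lehmer code records the first
  -- value x and then, recursively, the code of the rest after deleting x
  -- (punchOutℕ x): entries e₁ < n, e₂ < n − 1, …, so the reversed Lehmer code
  -- is an inversion sequence, and unlehmer inverts the construction.  Since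
  -- deleting a value preserves comparisons, the reversed Lehmer code of the
  -- reversed permutation has the same up/down word as the permutation, hence
  -- the same peaks:  permutations with peak set S ↔ Codes S n.

  open import Data.Nat using (ℕ; zero; suc; _<ᵇ_; _≡ᵇ_; _≤_; _<_)
  open import Data.Nat.Properties
  open import Data.Bool using (Bool; true; false; _∧_; not; T)
  open import Data.List using (List; []; _∷_; _++_; length; map; reverse)
  open import Data.List.Properties using (unfold-reverse; reverse-involutive; length-reverse; reverse-map; length-map)
  open import Data.Product using (_×_; _,_; proj₁; proj₂)
  open import Data.Empty using (⊥; ⊥-elim)
  open import Data.Unit using (tt)
  open import Relation.Binary.PropositionalEquality
  open import Function.Bundles using (_↔_)
  open import Defs using (peaksFrom)
  open Booleans
  open FiniteTypes
  open Codes
  open PunchInOut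

  allBelow : ℕ → List ℕ → Bool
  allBelow n [] = true
  allBelow n (x ∷ xs) = (x <ᵇ n) ∧ allBelow n xs

  notIn : ℕ → List ℕ → Bool
  notIn x [] = true
  notIn x (y ∷ ys) = not (x ≡ᵇ y) ∧ notIn x ys

  distinct : List ℕ → Bool
  distinct [] = true
  distinct (x ∷ xs) = notIn x xs ∧ distinct xs

  isPermList : ℕ → List ℕ → Bool
  isPermList n xs = (length xs ≡ᵇ n) ∧ (allBelow n xs ∧ distinct xs)

  isLehmer : ℕ → List ℕ → Bool
  isLehmer zero [] = true
  isLehmer zero (_ ∷ _) = false
  isLehmer (suc n) [] = false
  isLehmer (suc n) (e ∷ es) = (e <ᵇ suc n) ∧ isLehmer n es

  lehmer : ℕ → List ℕ → List ℕ
  lehmer zero _ = []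
  lehmer (suc n) [] = []
  lehmer (suc n) (x ∷ r) = x ∷ lehmer n (map (punchOutℕ x) r)

  unlehmer : List ℕ → List ℕ
  unlehmer [] = []
  unlehmer (e ∷ es) = e ∷ map (punchInℕ e) (unlehmer es)

  notIn-hd : ∀ x y ys → T (notIn x (y ∷ ys)) → x ≢ y
  notIn-hd x y ys p = not≡ᵇ⇒≢ (∧-fst p)

  notIn-tl : ∀ x y ys → T (notIn x (y ∷ ys)) → T (notIn x ys)
  notIn-tl x y ys p = ∧-snd {not (x ≡ᵇ y)} p

  notIn-cons : ∀ x y ys → x ≢ y → T (notIn x ys) → T (notIn x (y ∷ ys))
  notIn-cons x y ys ne p = ∧-intro (≢⇒not≡ᵇ ne) p

  notIn-++ : ∀ x xs ys → T (notIn x xs) → T (notIn x ys) → T (notIn x (xs ++ ys))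
  notIn-++ x [] ys p q = q
  notIn-++ x (y ∷ xs) ys p q = notIn-cons x y (xs ++ ys) (notIn-hd x y xs p) (notIn-++ x xs ys (notIn-tl x y xs p) q)

  notIn-reverse : ∀ x L → T (notIn x L) → T (notIn x (reverse L))
  notIn-reverse x [] p = tt
  notIn-reverse x (y ∷ L) p = subst (λ w → T (notIn x w)) (sym (unfold-reverse y L))
    (notIn-++ x (reverse L) (y ∷ []) (notIn-reverse x L (notIn-tl x y L p)) (notIn-cons x y [] (notIn-hd x y L p) tt))

  distinct-snoc : ∀ xs y → T (distinct xs) → T (notIn y xs) → T (distinct (xs ++ y ∷ []))
  distinct-snoc [] y p q = ∧-intro tt tt
  distinct-snoc (x ∷ xs) y p q = ∧-intro (notIn-++ x xs (y ∷ []) (∧-fst p) (notIn-cons x y [] (λ e → notIn-hd y x xs q (sym e)) tt))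
    (distinct-snoc xs y (∧-snd {notIn x xs} p) (notIn-tl y x xs q))

  distinct-reverse : ∀ L → T (distinct L) → T (distinct (reverse L))
  distinct-reverse [] p = tt
  distinct-reverse (y ∷ L) p = subst (λ w → T (distinct w)) (sym (unfold-reverse y L))
    (distinct-snoc (reverse L) y (distinct-reverse L (∧-snd {notIn y L} p)) (notIn-reverse y L (∧-fst p)))

  allBelow-++ : ∀ n xs ys → T (allBelow n xs) → T (allBelow n ys) → T (allBelow n (xs ++ ys))
  allBelow-++ n [] ys p q = q
  allBelow-++ n (x ∷ xs) ys p q = ∧-intro (∧-fst p) (allBelow-++ n xs ys (<ᵇ∧-tail x n p) q)

  allBelow-reverse : ∀ n L → T (allBelow n L) → T (allBelow n (reverse L))
  allBelow-reverse n [] p = tt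
  allBelow-reverse n (y ∷ L) p = subst (λ w → T (allBelow n w)) (sym (unfold-reverse y L))
    (allBelow-++ n (reverse L) (y ∷ []) (allBelow-reverse n L (<ᵇ∧-tail y n p)) (∧-intro (∧-fst p) tt))

  isPermList-reverse : ∀ n L → T (isPermList n L) → T (isPermList n (reverse L))
  isPermList-reverse n L p = ∧-intro (subst T (sym (cong (_≡ᵇ n) (length-reverse L))) (∧-fst p))
    (∧-intro (allBelow-reverse n L (∧-fst (∧-snd {length L ≡ᵇ n} p))) (distinct-reverse L (∧-snd {allBelow n L} (∧-snd {length L ≡ᵇ n} p))))

  isPermList-∷ : ∀ n x r → T (isPermList (suc n) (x ∷ r)) → (x < suc n) × T (notIn x r) × T (distinct r) × T (allBelow (suc n) r) × (length r ≡ n)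
  isPermList-∷ n x r p = <ᵇ∧-head x (suc n) a , ∧-fst d , ∧-snd {notIn x r} d , <ᵇ∧-tail x (suc n) a , suc-injective (≡ᵇ⇒≡ _ _ (∧-fst p))
    where
    a = ∧-fst (∧-snd {length (x ∷ r) ≡ᵇ suc n} p)
    d = ∧-snd {allBelow (suc n) (x ∷ r)} (∧-snd {length (x ∷ r) ≡ᵇ suc n} p)

  allBelow-punchOut : ∀ n x ys → x < suc n → T (allBelow (suc n) ys) → T (notIn x ys) → T (allBelow n (map (punchOutℕ x) ys))
  allBelow-punchOut n x [] hx p q = tt
  allBelow-punchOut n x (y ∷ ys) hx p q = ∧-intro (<⇒<ᵇ (punchOut-bound (<ᵇ∧-head y (suc n) p) (λ e → notIn-hd x y ys q (sym e)) hx)) (allBelow-punchOut n x ys hx (<ᵇ∧-tail y (suc n) p) (notIn-tl x y ys q))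

  notIn-punchOut : ∀ x y ys → y ≢ x → T (notIn x ys) → T (notIn y ys) → T (notIn (punchOutℕ x y) (map (punchOutℕ x) ys))
  notIn-punchOut x y [] ny p q = tt
  notIn-punchOut x y (z ∷ ys) ny p q = notIn-cons (punchOutℕ x y) (punchOutℕ x z) (map (punchOutℕ x) ys) ne (notIn-punchOut x y ys ny (notIn-tl x z ys p) (notIn-tl y z ys q))
    where
    ne : punchOutℕ x y ≢ punchOutℕ x z
    ne e = notIn-hd y z ys q (trans (sym (punchIn-punchOut x y ny)) (trans (cong (punchInℕ x) e) (punchIn-punchOut x z (λ e' → notIn-hd x z ys p (sym e')))))

  distinct-punchOut : ∀ x ys → T (notIn x ys) → T (distinct ys) → T (distinct (map (punchOutℕ x) ys))
  distinct-punchOut x [] p q = tt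
  distinct-punchOut x (y ∷ ys) p q = ∧-intro (notIn-punchOut x y ys (λ e → notIn-hd x y ys p (sym e)) (notIn-tl x y ys p) (∧-fst q)) (distinct-punchOut x ys (notIn-tl x y ys p) (∧-snd {notIn y ys} q))

  allBelow-punchIn : ∀ n x ys → x ≤ n → T (allBelow n ys) → T (allBelow (suc n) (map (punchInℕ x) ys))
  allBelow-punchIn n x [] hx p = tt
  allBelow-punchIn n x (y ∷ ys) hx p = ∧-intro (<⇒<ᵇ (punchIn-bound (<ᵇ∧-head y n p) hx)) (allBelow-punchIn n x ys hx (<ᵇ∧-tail y n p))

  notIn-punchIn-pivot : ∀ x ys → T (notIn x (map (punchInℕ x) ys))
  notIn-punchIn-pivot x [] = tt
  notIn-punchIn-pivot x (y ∷ ys) = notIn-cons x (punchInℕ x y) (map (punchInℕ x) ys) (λ e → punchIn-≢ x y (sym e)) (notIn-punchIn-pivot x ys)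

  notIn-punchIn : ∀ x y ys → T (notIn y ys) → T (notIn (punchInℕ x y) (map (punchInℕ x) ys))
  notIn-punchIn x y [] p = tt
  notIn-punchIn x y (z ∷ ys) p = notIn-cons (punchInℕ x y) (punchInℕ x z) (map (punchInℕ x) ys) ne (notIn-punchIn x y ys (notIn-tl y z ys p))
    where
    ne : punchInℕ x y ≢ punchInℕ x z
    ne e = notIn-hd y z ys p (trans (sym (punchOut-punchIn x y)) (trans (cong (punchOutℕ x) e) (punchOut-punchIn x z)))

  distinct-punchIn : ∀ x ys → T (distinct ys) → T (distinct (map (punchInℕ x) ys))
  distinct-punchIn x [] p = tt
  distinct-punchIn x (y ∷ ys) p = ∧-intro (notIn-punchIn x y ys (∧-fst p)) (distinct-punchIn x ys (∧-snd {notIn y ys} p))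

  map-punchIn-punchOut : ∀ x ys → T (notIn x ys) → map (punchInℕ x) (map (punchOutℕ x) ys) ≡ ys
  map-punchIn-punchOut x [] p = refl
  map-punchIn-punchOut x (y ∷ ys) p = cong₂ _∷_ (punchIn-punchOut x y (λ e → notIn-hd x y ys p (sym e))) (map-punchIn-punchOut x ys (notIn-tl x y ys p))

  map-punchOut-punchIn : ∀ x ys → map (punchOutℕ x) (map (punchInℕ x) ys) ≡ ys
  map-punchOut-punchIn x [] = refl
  map-punchOut-punchIn x (y ∷ ys) = cong₂ _∷_ (punchOut-punchIn x y) (map-punchOut-punchIn x ys)

  isPermList-standardise : ∀ n x r → T (isPermList (suc n) (x ∷ r)) → T (isPermList n (map (punchOutℕ x) r))
  isPermList-standardise n x r p with isPermList-∷ n x r p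
  ... | hx , ni , di , al , ln = ∧-intro (≡⇒≡ᵇ _ _ (trans (length-map (punchOutℕ x) r) ln)) (∧-intro (allBelow-punchOut n x r hx al ni) (distinct-punchOut x r ni di))

  isPermList-insert : ∀ n x D → x < suc n → T (isPermList n D) → T (isPermList (suc n) (x ∷ map (punchInℕ x) D))
  isPermList-insert n x D hx p = ∧-intro (≡⇒≡ᵇ _ _ (cong suc (trans (length-map (punchInℕ x) D) (≡ᵇ⇒≡ _ _ (∧-fst p)))))
    (∧-intro (∧-intro (<⇒<ᵇ hx) (allBelow-punchIn n x D (≤-pred hx) (∧-fst (∧-snd {length D ≡ᵇ n} p))))
        (∧-intro (notIn-punchIn-pivot x D) (distinct-punchIn x D (∧-snd {allBelow n D} (∧-snd {length D ≡ᵇ n} p)))))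

  lehmer-isLehmer : ∀ n R → T (isPermList n R) → T (isLehmer n (lehmer n R))
  lehmer-isLehmer zero [] p = tt
  lehmer-isLehmer zero (x ∷ R) p = ⊥-elim p
  lehmer-isLehmer (suc n) [] p = ⊥-elim p
  lehmer-isLehmer (suc n) (x ∷ r) p = ∧-intro (<⇒<ᵇ (proj₁ (isPermList-∷ n x r p))) (lehmer-isLehmer n (map (punchOutℕ x) r) (isPermList-standardise n x r p))

  unlehmer-isPermList : ∀ n e → T (isLehmer n e) → T (isPermList n (unlehmer e))
  unlehmer-isPermList zero [] p = tt
  unlehmer-isPermList (suc n) (a ∷ es) p = isPermList-insert n a (unlehmer es) (<ᵇ∧-head a (suc n) p) (unlehmer-isPermList n es (<ᵇ∧-tail a (suc n) p))

  lehmer-unlehmer : ∀ n e → T (isLehmer n e) → lehmer n (unlehmer e) ≡ e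
  lehmer-unlehmer zero [] p = refl
  lehmer-unlehmer (suc n) (a ∷ es) p = cong (a ∷_) (trans (cong (lehmer n) (map-punchOut-punchIn a (unlehmer es))) (lehmer-unlehmer n es (<ᵇ∧-tail a (suc n) p)))

  unlehmer-lehmer : ∀ n R → T (isPermList n R) → unlehmer (lehmer n R) ≡ R
  unlehmer-lehmer zero [] p = refl
  unlehmer-lehmer zero (x ∷ R) p = ⊥-elim p
  unlehmer-lehmer (suc n) [] p = ⊥-elim p
  unlehmer-lehmer (suc n) (x ∷ r) p = cong (x ∷_) (trans (cong (map (punchInℕ x)) (unlehmer-lehmer n (map (punchOutℕ x) r) (isPermList-standardise n x r p))) (map-punchIn-punchOut x r (proj₁ (proj₂ (isPermList-∷ n x r p)))))

  ascents-snoc₂ : ∀ L z x → ascents ((L ++ z ∷ []) ++ x ∷ []) ≡ ascents (L ++ z ∷ []) ++ (z <ᵇ x) ∷ []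
  ascents-snoc₂ [] z x = refl
  ascents-snoc₂ (a ∷ []) z x = refl
  ascents-snoc₂ (a ∷ b ∷ L) z x = cong ((a <ᵇ b) ∷_) (ascents-snoc₂ (b ∷ L) z x)

  ascents-reverse-∷ : ∀ x z w → ascents (reverse (x ∷ z ∷ w)) ≡ ascents (reverse (z ∷ w)) ++ (z <ᵇ x) ∷ []
  ascents-reverse-∷ x z w = trans (cong ascents (unfold-reverse x (z ∷ w)))
    (trans (cong (λ q → ascents (q ++ x ∷ [])) (unfold-reverse z w))
      (trans (ascents-snoc₂ (reverse w) z x) (cong (λ q → ascents q ++ (z <ᵇ x) ∷ []) (sym (unfold-reverse z w)))))

  ascents-punchOut : ∀ x L → T (notIn x L) → ascents (map (punchOutℕ x) L) ≡ ascents L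
  ascents-punchOut x [] p = refl
  ascents-punchOut x (a ∷ []) p = refl
  ascents-punchOut x (a ∷ b ∷ L) p = cong₂ _∷_ (<ᵇ-punchOut x a b (λ e → notIn-hd x a (b ∷ L) p (sym e)) (λ e → notIn-hd x b L (notIn-tl x a (b ∷ L) p) (sym e)))
    (ascents-punchOut x (b ∷ L) (notIn-tl x a (b ∷ L) p))

  lehmer-ascents : ∀ n R → T (isPermList n R) → ascents (reverse (lehmer n R)) ≡ ascents (reverse R)
  lehmer-ascents zero [] p = refl
  lehmer-ascents zero (x ∷ R) p = ⊥-elim p
  lehmer-ascents (suc n) [] p = ⊥-elim p
  lehmer-ascents (suc zero) (x ∷ []) p = refl
  lehmer-ascents (suc (suc n)) (x ∷ []) p = refl
  lehmer-ascents (suc zero) (x ∷ y ∷ r) p = ⊥-elim (case (proj₂ (proj₂ (proj₂ (proj₂ (isPermList-∷ zero x (y ∷ r) p))))))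
    where
    case : suc (length r) ≡ 0 → ⊥
    case ()
  lehmer-ascents (suc (suc n)) (x ∷ y ∷ r) p = begin
      ascents (reverse (x ∷ punchOutℕ x y ∷ lehmer n (map (punchOutℕ (punchOutℕ x y)) (map (punchOutℕ x) r))))
    ≡⟨ ascents-reverse-∷ x (punchOutℕ x y) (lehmer n (map (punchOutℕ (punchOutℕ x y)) (map (punchOutℕ x) r))) ⟩
      ascents (reverse (lehmer (suc n) (map (punchOutℕ x) (y ∷ r)))) ++ (punchOutℕ x y <ᵇ x) ∷ []
    ≡⟨ cong₂ (λ a b → a ++ b ∷ []) (lehmer-ascents (suc n) (map (punchOutℕ x) (y ∷ r)) (isPermList-standardise (suc n) x (y ∷ r) p)) (<ᵇ-punchOut-pivot x y (λ e → notIn-hd x y r ni (sym e))) ⟩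
      ascents (reverse (map (punchOutℕ x) (y ∷ r))) ++ (y <ᵇ x) ∷ []
    ≡⟨ cong (λ a → ascents a ++ (y <ᵇ x) ∷ []) (sym (reverse-map (punchOutℕ x) (y ∷ r))) ⟩
      ascents (map (punchOutℕ x) (reverse (y ∷ r))) ++ (y <ᵇ x) ∷ []
    ≡⟨ cong (λ a → a ++ (y <ᵇ x) ∷ []) (ascents-punchOut x (reverse (y ∷ r)) (notIn-reverse x (y ∷ r) ni)) ⟩
      ascents (reverse (y ∷ r)) ++ (y <ᵇ x) ∷ []
    ≡⟨ sym (ascents-reverse-∷ x y r) ⟩
      ascents (reverse (x ∷ y ∷ r))
    ∎
    where
    open ≡-Reasoning
    ni = proj₁ (proj₂ (isPermList-∷ (suc n) x (y ∷ r) p))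

  isLehmer⇒isCode-reverse : ∀ n e → T (isLehmer n e) → T (isCode 0 n (reverse e))
  isLehmer⇒isCode-reverse zero [] p = tt
  isLehmer⇒isCode-reverse (suc n) (a ∷ es) p = subst (λ w → T (isCode 0 (suc n) w)) (sym (unfold-reverse a es)) (isCode-snoc⁺ 0 n (reverse es) a (isLehmer⇒isCode-reverse n es (<ᵇ∧-tail a (suc n) p)) (<ᵇ∧-head a (suc n) p))

  isCode-reverse⇒isLehmer : ∀ n e → T (isCode 0 n (reverse e)) → T (isLehmer n e)
  isCode-reverse⇒isLehmer zero [] p = tt
  isCode-reverse⇒isLehmer zero (a ∷ es) p = ⊥-elim (absurd0 (reverse es) (subst (λ w → T (isCode 0 zero w)) (unfold-reverse a es) p))
    where
    absurd0 : ∀ t → T (isCode 0 zero (t ++ a ∷ [])) → ⊥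
    absurd0 [] ()
    absurd0 (_ ∷ _) ()
  isCode-reverse⇒isLehmer (suc n) [] p = ⊥-elim p
  isCode-reverse⇒isLehmer (suc n) (a ∷ es) p with isCode-snoc⁻ 0 n (reverse es) a (subst (λ w → T (isCode 0 (suc n) w)) (unfold-reverse a es) p)
  ... | q , r = ∧-intro (<⇒<ᵇ r) (isCode-reverse⇒isLehmer n es q)

  -- For lists of distinct values the peak test of Defs.peaksFrom only
  -- depends on the up/down word.
  peaksFrom-peaksAt : ∀ k a b r → T (distinct (b ∷ r)) → peaksFrom k (a ∷ b ∷ r) ≡ peaksAt (suc k) (a <ᵇ b) (ascents (b ∷ r))
  peaksFrom-peaksAt k a b [] d = refl
  peaksFrom-peaksAt k a b (c ∷ r) d rewrite <ᵇ-flip {b} {c} (notIn-hd b c r (∧-fst d)) with (a <ᵇ b) ∧ not (b <ᵇ c)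
  ... | true = cong (suc k ∷_) (peaksFrom-peaksAt (suc k) b c r (∧-snd {notIn b (c ∷ r)} d))
  ... | false = peaksFrom-peaksAt (suc k) b c r (∧-snd {notIn b (c ∷ r)} d)

  peaksFrom-codePeaks : ∀ xs → T (distinct xs) → peaksFrom 1 xs ≡ codePeaks xs
  peaksFrom-codePeaks [] d = refl
  peaksFrom-codePeaks (a ∷ []) d = refl
  peaksFrom-codePeaks (a ∷ b ∷ r) d = peaksFrom-peaksAt 1 a b r (∧-snd {notIn a (b ∷ r)} d)

  isPermListWith : List ℕ → ℕ → List ℕ → Bool
  isPermListWith S n xs = isPermList n xs ∧ list== (peaksFrom 1 xs) S

  isPermList-distinct : ∀ n xs → T (isPermList n xs) → T (distinct xs)
  isPermList-distinct n xs p = ∧-snd {allBelow n xs} (∧-snd {length xs ≡ᵇ n} p)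

  permLists-↔-Codes : ∀ S n → ListsWith (isPermListWith S n) ↔ Codes S n
  permLists-↔-Codes S n = restrict-↔ toCode fromCode toCode-ok fromCode-ok fromCode∘toCode toCode∘fromCode
    where
    toCode : List ℕ → List ℕ
    toCode xs = reverse (lehmer n (reverse xs))
    fromCode : List ℕ → List ℕ
    fromCode c = reverse (unlehmer (reverse c))
    toCode-ok : ∀ xs → T (isPermListWith S n xs) → T (isCodeWith S n (toCode xs))
    toCode-ok xs q = ∧-intro (isLehmer⇒isCode-reverse n (lehmer n (reverse xs)) (lehmer-isLehmer n (reverse xs) revPerm)) (list==-complete peaks)
      where
      revPerm = isPermList-reverse n xs (∧-fst q)
      peaks : codePeaks (toCode xs) ≡ S
      peaks = trans (cong (peaksAt 1 false) (trans (lehmer-ascents n (reverse xs) revPerm) (cong ascents (reverse-involutive xs))))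
             (trans (sym (peaksFrom-codePeaks xs (isPermList-distinct n xs (∧-fst q)))) (list==-sound _ _ (∧-snd {isPermList n xs} q)))
    fromCode-ok : ∀ c → T (isCodeWith S n c) → T (isPermListWith S n (fromCode c))
    fromCode-ok c q = ∧-intro perm (list==-complete peaks)
      where
      revLehmer : T (isLehmer n (reverse c))
      revLehmer = isCode-reverse⇒isLehmer n (reverse c) (subst (λ w → T (isCode 0 n w)) (sym (reverse-involutive c)) (∧-fst q))
      unlehmerPerm = unlehmer-isPermList n (reverse c) revLehmer
      perm = isPermList-reverse n (unlehmer (reverse c)) unlehmerPerm
      peaks : peaksFrom 1 (fromCode c) ≡ S
      peaks = trans (peaksFrom-codePeaks (fromCode c) (isPermList-distinct n (fromCode c) perm))
            (trans (cong (peaksAt 1 false) (trans (sym (lehmer-ascents n (unlehmer (reverse c)) unlehmerPerm))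
                     (trans (cong (λ w → ascents (reverse w)) (lehmer-unlehmer n (reverse c) revLehmer)) (cong ascents (reverse-involutive c)))))
                   (list==-sound _ _ (∧-snd {isCode 0 n c} q)))
    fromCode∘toCode : ∀ xs → T (isPermListWith S n xs) → fromCode (toCode xs) ≡ xs
    fromCode∘toCode xs q = trans (cong (λ w → reverse (unlehmer w)) (reverse-involutive (lehmer n (reverse xs))))
                (trans (cong reverse (unlehmer-lehmer n (reverse xs) (isPermList-reverse n xs (∧-fst q)))) (reverse-involutive xs))
    toCode∘fromCode : ∀ c → T (isCodeWith S n c) → toCode (fromCode c) ≡ c
    toCode∘fromCode c q = trans (cong (λ w → reverse (lehmer n w)) (reverse-involutive (unlehmer (reverse c))))
               (trans (cong reverse (lehmer-unlehmer n (reverse c) revLehmer)) (reverse-involutive c))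
      where
      revLehmer : T (isLehmer n (reverse c))
      revLehmer = isCode-reverse⇒isLehmer n (reverse c) (subst (λ w → T (isCode 0 n w)) (sym (reverse-involutive c)) (∧-fst q))


module PermutationVectors where

  open import Data.Nat using (ℕ; zero; suc; _≡ᵇ_)
  open import Data.Nat.Properties using (suc-injective; <⇒<ᵇ; ≡⇒≡ᵇ; ≡ᵇ⇒≡; _≟_)
  open import Data.Bool using (T)
  open import Data.Bool.Properties using (T-irrelevant)
  open import Data.Fin using (Fin; toℕ; fromℕ<)
  open import Data.Fin.Properties using (toℕ<n; toℕ-fromℕ<; fromℕ<-toℕ; toℕ-injective) renaming (_≟_ to _≟F_)
  open import Data.Vec using (Vec; toList) renaming ([] to []v; _∷_ to _∷v_)
  open import Data.List using (List; []; _∷_; length; map)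
  open import Data.List.Properties using (≡-dec)
  open import Data.List.Relation.Unary.All using (All) renaming ([] to []a; _∷_ to _∷a_)
  open import Data.List.Relation.Unary.AllPairs using () renaming ([] to []ap; _∷_ to _∷ap_)
  import Data.List.Relation.Unary.Unique.DecPropositional as UniqueDec
  open import Data.Product using (_,_)
  open import Data.Unit using (tt)
  open import Relation.Nullary using (¬_)
  open import Relation.Nullary.Decidable using (toWitness; fromWitness)
  open import Relation.Binary.PropositionalEquality
  open import Axiom.UniquenessOfIdentityProofs using (module Decidable⇒UIP)
  open import Function.Bundles using (_↔_; mk↔ₛ′)
  open import Defs using (PS; isPerm; peakSet; peaksFrom)
  open Booleans
  open FiniteTypes
  open LehmerCode

  asList : ∀ {n} → Vec (Fin n) n → List ℕ
  asList v = map toℕ (toList v)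

  length-asList : ∀ {n k} (w : Vec (Fin n) k) → length (map toℕ (toList w)) ≡ k
  length-asList []v = refl
  length-asList (x ∷v w) = cong suc (length-asList w)

  allBelow-asList : ∀ {n k} (w : Vec (Fin n) k) → T (allBelow n (map toℕ (toList w)))
  allBelow-asList []v = tt
  allBelow-asList (x ∷v w) = ∧-intro (<⇒<ᵇ (toℕ<n x)) (allBelow-asList w)

  notIn⇒All : ∀ {n} (x : Fin n) fs → T (notIn (toℕ x) (map toℕ fs)) → All (λ y → ¬ x ≡ y) fs
  notIn⇒All x [] p = []a
  notIn⇒All x (y ∷ fs) p = (λ e → notIn-hd (toℕ x) (toℕ y) (map toℕ fs) p (cong toℕ e)) ∷a notIn⇒All x fs (notIn-tl (toℕ x) (toℕ y) (map toℕ fs) p)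

  All⇒notIn : ∀ {n} (x : Fin n) fs → All (λ y → ¬ x ≡ y) fs → T (notIn (toℕ x) (map toℕ fs))
  All⇒notIn x [] p = tt
  All⇒notIn x (y ∷ fs) (h ∷a p) = notIn-cons (toℕ x) (toℕ y) (map toℕ fs) (λ e → h (toℕ-injective e)) (All⇒notIn x fs p)

  Unique⇒distinct : ∀ {n} (fs : List (Fin n)) → UniqueDec.Unique _≟F_ fs → T (distinct (map toℕ fs))
  Unique⇒distinct [] u = tt
  Unique⇒distinct (x ∷ fs) (h ∷ap u) = ∧-intro (All⇒notIn x fs h) (Unique⇒distinct fs u)

  distinct⇒Unique : ∀ {n} (fs : List (Fin n)) → T (distinct (map toℕ fs)) → UniqueDec.Unique _≟F_ fs
  distinct⇒Unique [] p = []ap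
  distinct⇒Unique (x ∷ fs) p = notIn⇒All x fs (∧-fst p) ∷ap distinct⇒Unique fs (∧-snd {notIn (toℕ x) (map toℕ fs)} p)

  fromList : ∀ n k (xs : List ℕ) → length xs ≡ k → T (allBelow n xs) → Vec (Fin n) k
  fromList n zero [] e a = []v
  fromList n (suc k) (x ∷ xs) e a = fromℕ< (<ᵇ∧-head x n a) ∷v fromList n k xs (suc-injective e) (<ᵇ∧-tail x n a)

  asList-fromList : ∀ n k xs e a → map toℕ (toList (fromList n k xs e a)) ≡ xs
  asList-fromList n zero [] e a = refl
  asList-fromList n (suc k) (x ∷ xs) e a = cong₂ _∷_ (toℕ-fromℕ< _) (asList-fromList n k xs (suc-injective e) (<ᵇ∧-tail x n a))

  fromList-asList : ∀ n k (w : Vec (Fin n) k) e a → fromList n k (map toℕ (toList w)) e a ≡ w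
  fromList-asList n zero []v e a = refl
  fromList-asList n (suc k) (x ∷v w) e a = cong₂ _∷v_ (fromℕ<-toℕ x _) (fromList-asList n k w (suc-injective e) (<ᵇ∧-tail (toℕ x) n a))

  -- Equality of lists of naturals is proof-irrelevant (Hedberg).
  list-≡-irrelevant : ∀ {a b : List ℕ} (p q : a ≡ b) → p ≡ q
  list-≡-irrelevant = Decidable⇒UIP.≡-irrelevant (≡-dec _≟_)

  PS-↔-permLists : ∀ S n → PS S n ↔ ListsWith (isPermListWith S n)
  PS-↔-permLists S n = mk↔ₛ′ to from to∘from from∘to
    where
    to : PS S n → ListsWith (isPermListWith S n)
    to (v , p , e) = asList v , ∧-intro (∧-intro (≡⇒≡ᵇ _ _ (length-asList v)) (∧-intro (allBelow-asList v) (Unique⇒distinct (toList v) (toWitness p)))) (list==-complete e)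
    from : ListsWith (isPermListWith S n) → PS S n
    from (xs , q) = v , fromWitness (distinct⇒Unique (toList v) (subst (λ w → T (distinct w)) (sym values≡) (isPermList-distinct n xs (∧-fst q)))) ,
                    trans (cong (peaksFrom 1) values≡) (list==-sound _ _ (∧-snd {isPermList n xs} q))
      where
      length≡ = ≡ᵇ⇒≡ _ _ (∧-fst (∧-fst q))
      bounded = ∧-fst (∧-snd {length xs ≡ᵇ n} (∧-fst q))
      v = fromList n n xs length≡ bounded
      values≡ : asList v ≡ xs
      values≡ = asList-fromList n n xs length≡ bounded
    to∘from : ∀ y → to (from y) ≡ y
    to∘from (xs , q) = witness-≡ (asList-fromList n n xs _ _)
    from∘to : ∀ x → from (to x) ≡ x
    from∘to (v , p , e) = PS-≡ (fromList-asList n n v _ _)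
      where
      PS-≡ : ∀ {v'} {p' : T (isPerm v')} {e' : peakSet v' ≡ S} → v' ≡ v → _≡_ {A = PS S n} (v' , p' , e') (v , p , e)
      PS-≡ {p' = p'} {e' = e'} refl = cong₂ (λ a b → v , a , b) (T-irrelevant p' p) (list-≡-irrelevant e' e)


module MainTheorem where

  open import Data.Nat using (ℕ; suc; _≤_; _<_; _∸_; _^_)
  open import Data.Nat.Properties using (<-trans; n<1+n)
  open import Data.List using (List; []; _∷_; _++_; length)
  open import Data.List.Relation.Unary.All using (All)
  import Data.List.Relation.Unary.All as All
  open import Data.List.Relation.Unary.All.Properties using (++⁻ʳ)
  open import Data.Product using (Σ; ∃; _×_; _,_; proj₁; proj₂)
  open import Data.Integer using (+_)
  open import Data.Rational using (ℚ; _/_; _*_; 1ℚ)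
  open import Data.Rational.Properties using (1≢0)
  open import Relation.Binary.PropositionalEquality
  open import Function.Bundles using (_↔_)
  open import Function.Properties.Inverse using (↔-trans)
  open import Defs using (PS; HasCard; IntegerValued; HasDegree; evalPoly; expectedDeg)
  open FiniteTypes
  open Codes
  open SeparatedSets
  open IntegerPolynomials
  open PeakPolynomials
  open LehmerCode
  open PermutationVectors

  PS-↔-Codes : ∀ S n → PS S n ↔ Codes S n
  PS-↔-Codes S n = ↔-trans (PS-↔-permLists S n) (permLists-↔-Codes S n)

  card-PS : ∀ S n m → HasCard (PS S n) m → m ≡ #Codes S n
  card-PS S n m h = card-unique (finite-Codes S n) (↔-trans h (PS-↔-Codes S n))

  PeakTheorem : List ℕ → Set
  PeakTheorem S = Σ (List ℚ) λ p → IntegerValued p × HasDegree p (expectedDeg S) ×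
    (∀ (n m : ℕ) → 1 ≤ n → HasCard (PS S n) m → m ≢ 0 →
      (+ m) / 1 ≡ evalPoly p (+ n) * ((+ (2 ^ (n ∸ length S ∸ 1))) / 1))

  peakTheorem-[] : PeakTheorem []
  peakTheorem-[] = poly , intValued , ([] , 1ℚ , refl , refl , 1≢0) , counts′
    where
    open PeakPolynomial peakPolynomial-[]
    counts′ : ∀ (n m : ℕ) → 1 ≤ n → HasCard (PS [] n) m → m ≢ 0 → (+ m) / 1 ≡ evalPoly poly (+ n) * ((+ (2 ^ (n ∸ 0 ∸ 1))) / 1)
    counts′ n m 1≤n hc _ = trans (cong (λ w → ι (+ w)) (card-PS [] n m hc)) (counts n 1≤n 1≤n)

  expectedDeg-snoc : ∀ S1 x → expectedDeg (S1 ++ x ∷ []) ≡ maxL (S1 ++ x ∷ []) ∸ 1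
  expectedDeg-snoc [] x = refl
  expectedDeg-snoc (z ∷ S1) x = refl

  peakTheorem-snoc : ∀ S1 x → (∃ λ n0 → #Codes (S1 ++ x ∷ []) n0 ≢ 0) → PeakTheorem (S1 ++ x ∷ [])
  peakTheorem-snoc S1 x (n0 , n0-has-code) with Codes-admissible (S1 ++ x ∷ []) n0 (proj₁ code) (proj₂ code)
    where code = #Codes-witness (S1 ++ x ∷ []) n0 n0-has-code
  ... | separated , _ with separated-last≥2 S1 x separated
  ... | k0 , refl = P , ivP , degree , counts′
    where
    open InductionStep S1 k0 separated
    open FromHypotheses (peakPolynomial-all (suc k) S1 (<-trans maxS1 (n<1+n k)))
                        (peakPolynomial-all (suc k) S2 (subst (_< suc k) (sym maxS2) (n<1+n k)))
    degree : HasDegree P (expectedDeg S)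
    degree = subst (HasDegree P) (sym (trans (expectedDeg-snoc S1 m) (cong (_∸ 1) maxS))) (degP (c≢0 n0 n0-has-code))
    counts′ : ∀ (n m′ : ℕ) → 1 ≤ n → HasCard (PS S n) m′ → m′ ≢ 0 →
      (+ m′) / 1 ≡ evalPoly P (+ n) * ((+ (2 ^ (n ∸ length S ∸ 1))) / 1)
    counts′ n m′ _ hc m′≢0 with card-PS S n m′ hc
    ... | refl with <⇒+suc k n (All.head (++⁻ʳ S1 (proj₂ (Codes-admissible S n (proj₁ code) (proj₂ code)))))
      where code = #Codes-witness S n m′≢0
    ... | l0 , refl = peakFormula l0


open import Defs
open import Data.Nat using (ℕ; _≤_; _∸_; _^_)
open import Data.List using (List; []; _∷_; _++_; length)
open import Data.Integer using (+_)
open import Data.Rational using (ℚ; _/_; _*_)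
open import Data.Product using (Σ; _×_; _,_)
open import Relation.Binary.PropositionalEquality using (_≡_; _≢_; subst; sym; trans)
open Codes using (#Codes; initL; lastL; initLast)
open MainTheorem using (PeakTheorem; peakTheorem-[]; peakTheorem-snoc; card-PS)

theorem1p1 : (S : List ℕ) → IsFinPosSet S → Admissible S →
    Σ (List ℚ) λ p → IntegerValued p × HasDegree p (expectedDeg S) ×
    (∀ (n m : ℕ) → 1 ≤ n → HasCard (PS S n) m → m ≢ 0 →
    (+ m) / 1 ≡ evalPoly p (+ n) * ((+ (2 ^ (n ∸ length S ∸ 1))) / 1))
theorem1p1 [] _ _ = peakTheorem-[]
theorem1p1 (y ∷ t) _ (n₀ , _ , m₀ , card-m₀ , m₀≢0) =
  subst PeakTheorem (initLast y t) (peakTheorem-snoc (initL (y ∷ t)) (lastL (y ∷ t)) (n₀ , has-code))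
  where
  has-code : #Codes (initL (y ∷ t) ++ lastL (y ∷ t) ∷ []) n₀ ≢ 0
  has-code = subst (λ S → #Codes S n₀ ≢ 0) (sym (initLast y t)) (λ e → m₀≢0 (trans (card-PS (y ∷ t) n₀ m₀ card-m₀) e))
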